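{- Let $K=\mathbb{Q}(\sqrt{d})$ be a real quadratic field with discriminant $d_{K}$. Then for every Pisot number $\zeta$ with $\mathbb{Q}(\zeta)=K$ (equivalently, every Pisot number $\zeta\in K\setminus\mathbb{Z}$) we have $1/\sqrt{d_{K}}\in\mathscr{M}_{\zeta}$. In particular $\mathcal{O}_{K}\subsetneq\bigcap_{\zeta\in S_{K}}\mathscr{M}_{\zeta}$.
   Context: A Pisot number is a real algebraic integer $\zeta>1$ all of whose conjugates other than $\zeta$ lie strictly inside the unit circle of $\mathbb{C}$; for a number field $K$, $S_{K}$ is the set of Pisot numbers $\zeta$ with $\mathbb{Q}(\zeta)=K$. For real $\zeta>1$, $\mathscr{M}_{\zeta}$ denotes the set of all $\alpha\in\mathbb{R}$ with $\Vert\alpha\zeta^{n}\Vert\to0$ as $n\to\infty$, where $\Vert x\Vert$ is the distance from $x$ to the nearest integer. $\mathcal{O}_{K}$ is the ring of integers of $K$ and $d_{K}$ is the discriminant of the number field $K$ (for square-free $d>1$: $d_{K}=d$ if $d\equiv1\bmod4$, $d_{K}=4d$ otherwise). -}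

module Defs where

open import Data.Nat as ℕ using (ℕ; zero; suc)
open import Data.Nat.DivMod using (_%_)
open import Data.Nat.Divisibility using (_∣_)
open import Data.Integer as ℤ using (ℤ; +_)
open import Data.Rational as ℚ using (ℚ; 0ℚ; 1ℚ; _/_)
open import Data.Product using (Σ; _×_; _,_; ∃)
open import Data.Sum using (_⊎_)
open import Relation.Binary.PropositionalEquality using (_≡_; _≢_)

SquareFree : ℕ → Set
SquareFree d = ∀ p → p ℕ.* p ∣ d → p ≡ 1

-- Elements x + y√d of K = ℚ(√d), stored by their rational coordinates.
record K : Set where
  constructor ⟨_,_⟩
  field
    re : ℚ
    im : ℚ
open K public

ℚof : ℕ → ℚ
ℚof n = + n / 1

ι : ℚ → K
ι q = ⟨ q , 0ℚ ⟩

ιℤ : ℤ → K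
ιℤ m = ι (m / 1)

0K 1K : K
0K = ι 0ℚ
1K = ι 1ℚ

module Arith (d : ℕ) where
  infixl 6 _+K_ _-K_
  infixl 7 _*K_
  infix 4 _<K_

  _+K_ : K → K → K
  ⟨ a , b ⟩ +K ⟨ c , e ⟩ = ⟨ a ℚ.+ c , b ℚ.+ e ⟩

  -K_ : K → K
  -K ⟨ a , b ⟩ = ⟨ ℚ.- a , ℚ.- b ⟩

  _-K_ : K → K → K
  x -K y = x +K (-K y)

  _*K_ : K → K → K
  ⟨ a , b ⟩ *K ⟨ c , e ⟩ = ⟨ a ℚ.* c ℚ.+ ℚof d ℚ.* b ℚ.* e , a ℚ.* e ℚ.+ b ℚ.* c ⟩

  _^K_ : K → ℕ → K
  x ^K zero = 1K
  x ^K suc n = x *K (x ^K n)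

  σ : K → K
  σ ⟨ a , b ⟩ = ⟨ a , ℚ.- b ⟩

  -- x + y√d > 0 as a real number (√d the positive square root, d > 0).
  Pos : K → Set
  Pos ⟨ x , y ⟩ =
      (0ℚ ℚ.≤ x × 0ℚ ℚ.≤ y × (0ℚ ℚ.< x ⊎ 0ℚ ℚ.< y))
    ⊎ (0ℚ ℚ.< x × y ℚ.< 0ℚ × ℚof d ℚ.* y ℚ.* y ℚ.< x ℚ.* x)
    ⊎ (x ℚ.< 0ℚ × 0ℚ ℚ.< y × x ℚ.* x ℚ.< ℚof d ℚ.* y ℚ.* y)

  _<K_ : K → K → Set
  x <K y = Pos (y -K x)

  -- Algebraic integer: root of a monic integer polynomial (degree ≤ 2
  -- suffices in a quadratic field: the characteristic polynomial).
  IsAlgInt : K → Set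
  IsAlgInt α = Σ ℤ λ b → Σ ℤ λ c → α *K α +K ιℤ b *K α +K ιℤ c ≡ 0K

  -- ζ ∈ S_K: Pisot number with ℚ(ζ) = K.  Its conjugates other than ζ
  -- are just σ ζ (ζ has degree 2 as it is irrational).
  IsPisotK : K → Set
  IsPisotK ζ = IsAlgInt ζ × im ζ ≢ 0ℚ × 1K <K ζ × (-K 1K) <K σ ζ × σ ζ <K 1K

  -- α ∈ 𝓜_ζ (for α ∈ K): ‖α ζ^n‖ → 0, i.e. for every rational ε > 0
  -- there is N such that for all n ≥ N, α ζ^n is within ε of an integer.
  InM : K → K → Set
  InM ζ α = ∀ (ε : ℚ) → 0ℚ ℚ.< ε → ∃ λ (N : ℕ) → ∀ (n : ℕ) → N ℕ.≤ n →
    ∃ λ (m : ℤ) → (-K ι ε) <K (α *K (ζ ^K n) -K ιℤ m) × (α *K (ζ ^K n) -K ιℤ m) <K ι ε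

dKaux : ℕ → ℕ → ℕ
dKaux d 1 = d
dKaux d _ = 4 ℕ.* d

dK : ℕ → ℕ
dK d = dKaux d (d % 4)

sqrtDKaux : ℕ → K
sqrtDKaux 1 = ⟨ 0ℚ , 1ℚ ⟩
sqrtDKaux _ = ⟨ 0ℚ , ℚof 2 ⟩         -- 2√d = √(4d)

sqrtDK : ℕ → K
sqrtDK d = sqrtDKaux (d % 4)

{-# OPTIONS --safe #-}
module Submission where

-- Write α ζⁿ = mₙ + c (σζ)ⁿ with mₙ ∈ ℤ and a fixed c ∈ K.  For an algebraic integer α, mₙ is the
-- trace of α ζⁿ and c = −σα.  For α √d_K = 1, write ζⁿ = u + v θ in an integral basis {1, θ} with
-- θ − σθ = √d_K; then mₙ = v and c = α.  Since |σζ| < 1 the error c (σζ)ⁿ tends to 0.  Finally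
-- 1/√d_K is no algebraic integer: its square 1/d_K is a rational non-integer.
--
-- No real numbers are needed: the sign of x + y√d is decided by comparing x² with d y², every
-- positive element exceeds a positive rational, and so |σζ| < 1 improves to |σζ| < r < 1, r ∈ ℚ.

open import Data.Nat as ℕ using (ℕ; zero; suc; z≤n; s≤s)
import Data.Nat.Properties as ℕ
import Data.Nat.DivMod as ℕ
import Data.Nat.Divisibility as ℕ
import Data.Nat.Coprimality as Coprime
import Data.Nat.Tactic.RingSolver as ℕ-Solver
open import Data.Integer as ℤ using (ℤ; +_)
import Data.Integer.Properties as ℤ
import Data.Integer.DivMod as ℤ
open import Data.Integer.Divisibility.Signed using (_∣_; divides; _∣?_; ∣m∣n⇒∣m+n; ∣m∣n⇒∣m-n; ∣n⇒∣m*n)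
import Data.Integer.Tactic.RingSolver as ℤ-Solver
open import Data.Rational as ℚ using (ℚ; mkℚ; 0ℚ; 1ℚ; _/_; 1/_; ↥_; ↧_; ↧ₙ_)
open import Data.Rational.Properties
import Data.Rational.Unnormalised as ℚᵘ
import Data.Rational.Unnormalised.Properties as ℚᵘ
open import Algebra.Bundles using (CommutativeRing)
open import Algebra.Definitions.RawSemiring +-*-rawSemiring using (_^_)
open import Algebra.Structures using (IsCommutativeRing)
import Algebra.Solver.Ring
import Algebra.Solver.Ring.AlmostCommutativeRing as ACR
open import Data.Empty using (⊥-elim)
import Data.Maybe as Maybe
open import Data.Product using (Σ; ∃; _×_; _,_; proj₁; proj₂)
open import Data.Sum using (_⊎_; inj₁; inj₂)
open import Function using (_∘_)
open import Relation.Binary.Definitions using (tri<; tri≈; tri>)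
open import Relation.Binary.PropositionalEquality
  using (_≡_; _≢_; refl; sym; trans; cong; cong₂; subst; subst₂; isEquivalence; module ≡-Reasoning)
open import Relation.Nullary using (¬_; Dec; yes; no)
open import Relation.Nullary.Decidable using (dec⇒maybe; False; toWitnessFalse)
open import Tactic.RingSolver using (solve-∀)
open import Tactic.RingSolver.Core.AlmostCommutativeRing using (AlmostCommutativeRing; fromCommutativeRing)

open import Defs

module Rationals where

  open import Data.Rational using (_+_; _*_; _-_; -_; _<_; _≤_)

  ℚ-ring : AlmostCommutativeRing _ _
  ℚ-ring = fromCommutativeRing +-*-commutativeRing (λ x → dec⇒maybe (0ℚ ≟ x))

  -- The normal form of m / 1 (the embedding used in Defs), on which ↥ and ↧ compute.
  fromℤ : ℤ → ℚ
  fromℤ m = mkℚ m 0 (Coprime.sym (Coprime.1-coprimeTo ℤ.∣ m ∣))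

  m/1≡fromℤ : ∀ m → m / 1 ≡ fromℤ m
  m/1≡fromℤ m = ↥p/↧p≡p (fromℤ m)

  fromℤ-injective : ∀ {m n} → fromℤ m ≡ fromℤ n → m ≡ n
  fromℤ-injective refl = refl

  fromℤ-homo-+ : ∀ m n → fromℤ (m ℤ.+ n) ≡ fromℤ m + fromℤ n
  fromℤ-homo-+ m n = toℚᵘ-injective
    (ℚᵘ.≃-trans (ℚᵘ.*≡* (lemma m n)) (ℚᵘ.≃-sym (toℚᵘ-homo-+ (fromℤ m) (fromℤ n))))
    where
    lemma : ∀ m n → (m ℤ.+ n) ℤ.* (+ 1 ℤ.* + 1) ≡ (m ℤ.* + 1 ℤ.+ n ℤ.* + 1) ℤ.* + 1
    lemma = ℤ-Solver.solve-∀

  fromℤ-homo-* : ∀ m n → fromℤ (m ℤ.* n) ≡ fromℤ m * fromℤ n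
  fromℤ-homo-* m n = toℚᵘ-injective
    (ℚᵘ.≃-trans (ℚᵘ.*≡* (lemma m n)) (ℚᵘ.≃-sym (toℚᵘ-homo-* (fromℤ m) (fromℤ n))))
    where
    lemma : ∀ m n → (m ℤ.* n) ℤ.* (+ 1 ℤ.* + 1) ≡ (m ℤ.* n) ℤ.* + 1
    lemma = ℤ-Solver.solve-∀

  fromℤ-homo‿- : ∀ m → fromℤ (ℤ.- m) ≡ - fromℤ m
  fromℤ-homo‿- m = toℚᵘ-injective (ℚᵘ.≃-trans (ℚᵘ.*≡* refl) (ℚᵘ.≃-sym (toℚᵘ-homo‿- (fromℤ m))))

  fromℤ-mono-< : ∀ {m n} → m ℤ.< n → fromℤ m < fromℤ n
  fromℤ-mono-< {m} {n} m<n = ℚ.*<* (subst₂ ℤ._<_ (sym (ℤ.*-identityʳ m)) (sym (ℤ.*-identityʳ n)) m<n)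

  fromℤ-mono-≤ : ∀ {m n} → m ℤ.≤ n → fromℤ m ≤ fromℤ n
  fromℤ-mono-≤ {m} {n} m≤n = ℚ.*≤* (subst₂ ℤ._≤_ (sym (ℤ.*-identityʳ m)) (sym (ℤ.*-identityʳ n)) m≤n)

  p*↧p≡↥p : ∀ p → p * fromℤ (↧ p) ≡ fromℤ (↥ p)
  p*↧p≡↥p p@(mkℚ n d-1 _) = toℚᵘ-injective
    (ℚᵘ.≃-trans (toℚᵘ-homo-* p (fromℤ (↧ p))) (ℚᵘ.*≡* (lemma n (+ suc d-1))))
    where
    lemma : ∀ n d → (n ℤ.* d) ℤ.* + 1 ≡ n ℤ.* (d ℤ.* + 1)
    lemma = ℤ-Solver.solve-∀

  IsInteger : ℚ → Set
  IsInteger p = Σ ℤ λ m → p ≡ fromℤ m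

  ↧ₙ≡1⇒isInteger : ∀ p → ↧ₙ p ≡ 1 → IsInteger p
  ↧ₙ≡1⇒isInteger (mkℚ n zero _) refl = n , refl

  coprime-divisor² : ∀ {s n a} → Coprime.Coprime s n → s ℕ.∣ n ℕ.* (n ℕ.* a) → s ℕ.∣ a
  coprime-divisor² c = Coprime.coprime-divisor c ∘ Coprime.coprime-divisor c

  ↧ₙ∣↥²⇒isInteger : ∀ p → ↧ₙ p ℕ.∣ ℤ.∣ ↥ p ∣ ℕ.* ℤ.∣ ↥ p ∣ → IsInteger p
  ↧ₙ∣↥²⇒isInteger p@(mkℚ n _ cop) s∣n² = ↧ₙ≡1⇒isInteger p
    (ℕ.∣1⇒≡1 (coprime-divisor² (Coprime.sym (Coprime.recompute cop))
      (subst (ℕ._∣_ (↧ₙ p)) (cong (ℤ.∣ n ∣ ℕ.*_) (sym (ℕ.*-identityʳ ℤ.∣ n ∣))) s∣n²)))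

  monic-root-isInteger : ∀ b c p → p * p + fromℤ b * p + fromℤ c ≡ 0ℚ → IsInteger p
  monic-root-isInteger b c p eq = ↧ₙ∣↥²⇒isInteger p (ℕ.divides ℤ.∣ k ∣ ∣n∣²≡∣k∣s)
    where
    n = ↥ p
    s = ↧ p
    N = fromℤ n
    S = fromℤ s
    B = fromℤ b
    C = fromℤ c
    k = ℤ.- (b ℤ.* n ℤ.+ c ℤ.* s)
    identity : ∀ p B C S → (p * S) * (p * S) + (B * (p * S) + C * S) * S ≡ (p * p + B * p + C) * (S * S)
    identity = solve-∀ ℚ-ring
    n²+[bn+cs]s≡0 : fromℤ (n ℤ.* n ℤ.+ (b ℤ.* n ℤ.+ c ℤ.* s) ℤ.* s) ≡ fromℤ (+ 0)
    n²+[bn+cs]s≡0 = begin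
      fromℤ (n ℤ.* n ℤ.+ (b ℤ.* n ℤ.+ c ℤ.* s) ℤ.* s)
        ≡⟨ fromℤ-homo-+ (n ℤ.* n) _ ⟩
      fromℤ (n ℤ.* n) + fromℤ ((b ℤ.* n ℤ.+ c ℤ.* s) ℤ.* s)
        ≡⟨ cong₂ _+_ (fromℤ-homo-* n n) (fromℤ-homo-* (b ℤ.* n ℤ.+ c ℤ.* s) s) ⟩
      N * N + fromℤ (b ℤ.* n ℤ.+ c ℤ.* s) * S
        ≡⟨ cong (λ t → N * N + t * S) (trans (fromℤ-homo-+ (b ℤ.* n) (c ℤ.* s))
                                            (cong₂ _+_ (fromℤ-homo-* b n) (fromℤ-homo-* c s))) ⟩
      N * N + (B * N + C * S) * S
        ≡⟨ cong (λ t → t * t + (B * t + C * S) * S) (sym (p*↧p≡↥p p)) ⟩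
      (p * S) * (p * S) + (B * (p * S) + C * S) * S
        ≡⟨ identity p B C S ⟩
      (p * p + B * p + C) * (S * S)
        ≡⟨ cong (_* (S * S)) eq ⟩
      0ℚ * (S * S)
        ≡⟨ *-zeroˡ (S * S) ⟩
      0ℚ ∎
      where open ≡-Reasoning
    n²≡ks : n ℤ.* n ≡ k ℤ.* s
    n²≡ks = begin
      n ℤ.* n
        ≡⟨ lemma (n ℤ.* n) (b ℤ.* n ℤ.+ c ℤ.* s) s ⟩
      (n ℤ.* n ℤ.+ (b ℤ.* n ℤ.+ c ℤ.* s) ℤ.* s) ℤ.+ k ℤ.* s
        ≡⟨ cong (ℤ._+ k ℤ.* s) (fromℤ-injective n²+[bn+cs]s≡0) ⟩
      + 0 ℤ.+ k ℤ.* s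
        ≡⟨ ℤ.+-identityˡ (k ℤ.* s) ⟩
      k ℤ.* s ∎
      where
      open ≡-Reasoning
      lemma : ∀ a e s → a ≡ (a ℤ.+ e ℤ.* s) ℤ.+ (ℤ.- e) ℤ.* s
      lemma = ℤ-Solver.solve-∀
    ∣n∣²≡∣k∣s : ℤ.∣ n ∣ ℕ.* ℤ.∣ n ∣ ≡ ℤ.∣ k ∣ ℕ.* ↧ₙ p
    ∣n∣²≡∣k∣s = trans (sym (ℤ.abs-* n n)) (trans (cong ℤ.∣_∣ n²≡ks) (ℤ.abs-* k s))

  coprime-square-divisor : ∀ {s n k m} .{{_ : ℕ.NonZero s}} → Coprime.Coprime s n →
                           k ℕ.* (n ℕ.* n) ≡ m ℕ.* (s ℕ.* s) → s ℕ.* s ℕ.∣ k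
  coprime-square-divisor {s} {n} {k} {m} c eq = ℕ.divides r (begin
    k              ≡⟨ ℕ._∣_.equality s∣k ⟩
    q ℕ.* s        ≡⟨ cong (ℕ._* s) (ℕ._∣_.equality s∣q) ⟩
    r ℕ.* s ℕ.* s  ≡⟨ ℕ.*-assoc r s s ⟩
    r ℕ.* (s ℕ.* s) ∎)
    where
    open ≡-Reasoning
    swap : ∀ n k → n ℕ.* (n ℕ.* k) ≡ k ℕ.* (n ℕ.* n)
    swap = ℕ-Solver.solve-∀
    s∣k : s ℕ.∣ k
    s∣k = coprime-divisor² c (ℕ.divides (m ℕ.* s) (trans (swap n k) (trans eq (sym (ℕ.*-assoc m s s)))))
    q = ℕ._∣_.quotient s∣k
    q[n*n]≡ms : q ℕ.* (n ℕ.* n) ≡ m ℕ.* s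
    q[n*n]≡ms = ℕ.*-cancelˡ-≡ _ _ s (begin
      s ℕ.* (q ℕ.* (n ℕ.* n))  ≡⟨ lemma s q (n ℕ.* n) ⟩
      q ℕ.* s ℕ.* (n ℕ.* n)    ≡⟨ cong (ℕ._* (n ℕ.* n)) (ℕ._∣_.equality s∣k) ⟨
      k ℕ.* (n ℕ.* n)          ≡⟨ eq ⟩
      m ℕ.* (s ℕ.* s)          ≡⟨ lemma′ m s ⟩
      s ℕ.* (m ℕ.* s)          ∎)
      where
      lemma : ∀ s q a → s ℕ.* (q ℕ.* a) ≡ q ℕ.* s ℕ.* a
      lemma = ℕ-Solver.solve-∀
      lemma′ : ∀ m s → m ℕ.* (s ℕ.* s) ≡ s ℕ.* (m ℕ.* s)
      lemma′ = ℕ-Solver.solve-∀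
    s∣q : s ℕ.∣ q
    s∣q = coprime-divisor² c (ℕ.divides m (trans (swap n q) q[n*n]≡ms))
    r = ℕ._∣_.quotient s∣q

  squarefree-isInteger : ∀ {k} → SquareFree k → ∀ p → IsInteger (fromℤ (+ k) * (p * p)) → IsInteger p
  squarefree-isInteger {k} sf p@(mkℚ n s-1 cop) (m , eq) =
    ↧ₙ≡1⇒isInteger p (sf (↧ₙ p) (coprime-square-divisor {m = ℤ.∣ m ∣} (Coprime.sym (Coprime.recompute cop)) in-ℕ))
    where
    s = ↧ p
    S = fromℤ s
    K' = fromℤ (+ k)
    identity : ∀ K p S → K * ((p * S) * (p * S)) ≡ (K * (p * p)) * (S * S)
    identity = solve-∀ ℚ-ring
    in-ℤ : + k ℤ.* (n ℤ.* n) ≡ m ℤ.* (s ℤ.* s)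
    in-ℤ = fromℤ-injective (begin
      fromℤ (+ k ℤ.* (n ℤ.* n))     ≡⟨ trans (fromℤ-homo-* (+ k) (n ℤ.* n)) (cong (K' *_) (fromℤ-homo-* n n)) ⟩
      K' * (fromℤ n * fromℤ n)      ≡⟨ cong (λ t → K' * (t * t)) (sym (p*↧p≡↥p p)) ⟩
      K' * ((p * S) * (p * S))      ≡⟨ identity K' p S ⟩
      (K' * (p * p)) * (S * S)      ≡⟨ cong (_* (S * S)) eq ⟩
      fromℤ m * (S * S)             ≡⟨ trans (fromℤ-homo-* m (s ℤ.* s)) (cong (fromℤ m *_) (fromℤ-homo-* s s)) ⟨
      fromℤ (m ℤ.* (s ℤ.* s))       ∎)
      where open ≡-Reasoning
    in-ℕ : k ℕ.* (ℤ.∣ n ∣ ℕ.* ℤ.∣ n ∣) ≡ ℤ.∣ m ∣ ℕ.* (↧ₙ p ℕ.* ↧ₙ p)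
    in-ℕ = begin
      k ℕ.* (ℤ.∣ n ∣ ℕ.* ℤ.∣ n ∣)   ≡⟨ trans (ℤ.abs-* (+ k) (n ℤ.* n)) (cong (k ℕ.*_) (ℤ.abs-* n n)) ⟨
      ℤ.∣ + k ℤ.* (n ℤ.* n) ∣       ≡⟨ cong ℤ.∣_∣ in-ℤ ⟩
      ℤ.∣ m ℤ.* (s ℤ.* s) ∣         ≡⟨ ℤ.abs-* m (s ℤ.* s) ⟩
      ℤ.∣ m ∣ ℕ.* (↧ₙ p ℕ.* ↧ₙ p)   ∎
      where open ≡-Reasoning

  0<1 : 0ℚ < 1ℚ
  0<1 = ℚ.*<* (ℤ.+<+ (s≤s z≤n))

  pos+pos : ∀ {p q} → 0ℚ < p → 0ℚ < q → 0ℚ < p + q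
  pos+pos = +-mono-<

  pos+nonNeg : ∀ {p q} → 0ℚ < p → 0ℚ ≤ q → 0ℚ < p + q
  pos+nonNeg = +-mono-<-≤

  nonNeg+pos : ∀ {p q} → 0ℚ ≤ p → 0ℚ < q → 0ℚ < p + q
  nonNeg+pos = +-mono-≤-<

  nonNeg+nonNeg : ∀ {p q} → 0ℚ ≤ p → 0ℚ ≤ q → 0ℚ ≤ p + q
  nonNeg+nonNeg = +-mono-≤

  pos*pos : ∀ {p q} → 0ℚ < p → 0ℚ < q → 0ℚ < p * q
  pos*pos {p} {q} 0<p 0<q = positive⁻¹ (p * q) {{pos*pos⇒pos p {{ℚ.positive 0<p}} q {{ℚ.positive 0<q}}}}

  nonNeg*nonNeg : ∀ {p q} → 0ℚ ≤ p → 0ℚ ≤ q → 0ℚ ≤ p * q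
  nonNeg*nonNeg {p} {q} 0≤p 0≤q =
    nonNegative⁻¹ (p * q) {{nonNeg*nonNeg⇒nonNeg p {{ℚ.nonNegative 0≤p}} q {{ℚ.nonNegative 0≤q}}}}

  private
    q-p+p≡q : ∀ p q → (q - p) + p ≡ q
    q-p+p≡q = solve-∀ ℚ-ring
    p-p≡0 : ∀ p → p - p ≡ 0ℚ
    p-p≡0 = solve-∀ ℚ-ring

  p<q⇒0<q-p : ∀ {p q} → p < q → 0ℚ < q - p
  p<q⇒0<q-p {p} {q} p<q = subst (_< q - p) (p-p≡0 p) (+-monoˡ-< (- p) p<q)

  0<q-p⇒p<q : ∀ {p q} → 0ℚ < q - p → p < q
  0<q-p⇒p<q {p} {q} 0<q-p = subst₂ _<_ (+-identityˡ p) (q-p+p≡q p q) (+-monoˡ-< p 0<q-p)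

  p≤q⇒0≤q-p : ∀ {p q} → p ≤ q → 0ℚ ≤ q - p
  p≤q⇒0≤q-p {p} {q} p≤q = subst (_≤ q - p) (p-p≡0 p) (+-monoˡ-≤ (- p) p≤q)

  0≤q-p⇒p≤q : ∀ {p q} → 0ℚ ≤ q - p → p ≤ q
  0≤q-p⇒p≤q {p} {q} 0≤q-p = subst₂ _≤_ (+-identityˡ p) (q-p+p≡q p q) (+-monoˡ-≤ p 0≤q-p)

  square-nonNeg : ∀ p → 0ℚ ≤ p * p
  square-nonNeg p with ≤-total 0ℚ p
  ... | inj₁ 0≤p = nonNeg*nonNeg 0≤p 0≤p
  ... | inj₂ p≤0 = subst (0ℚ ≤_) (neg*neg p) (nonNeg*nonNeg (neg-antimono-≤ p≤0) (neg-antimono-≤ p≤0))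
    where
    neg*neg : ∀ p → - p * - p ≡ p * p
    neg*neg = solve-∀ ℚ-ring

  square-pos : ∀ {p} → p ≢ 0ℚ → 0ℚ < p * p
  square-pos {p} p≢0 with <-cmp 0ℚ p
  ... | tri< 0<p _ _ = pos*pos 0<p 0<p
  ... | tri≈ _ 0≡p _ = ⊥-elim (p≢0 (sym 0≡p))
  ... | tri> _ _ p<0 = subst (0ℚ <_) (neg*neg p) (pos*pos (neg-antimono-< p<0) (neg-antimono-< p<0))
    where
    neg*neg : ∀ p → - p * - p ≡ p * p
    neg*neg = solve-∀ ℚ-ring

  ≤-numerator : ∀ p → p ≤ fromℤ (+ ℤ.∣ ↥ p ∣)
  ≤-numerator (mkℚ (+ n) _ _)    = ℚ.*≤* (ℤ.*-monoˡ-≤-nonNeg (+ n) (ℤ.+≤+ (s≤s z≤n)))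
  ≤-numerator (mkℚ ℤ.-[1+ n ] _ _) = ℚ.*≤* ℤ.-≤+

  archimedean : ∀ p ε → 0ℚ < ε → ∃ λ N → p < fromℤ (+ N) * ε
  archimedean p ε 0<ε = N , subst (_< fromℤ (+ N) * ε) p/ε*ε≡p (*-monoˡ-<-pos ε {{ℚ.positive 0<ε}} p/ε<N)
    where
    instance _ = pos⇒nonZero ε {{ℚ.positive 0<ε}}
    N = suc ℤ.∣ ↥ (p * 1/ ε) ∣
    p/ε<N : p * 1/ ε < fromℤ (+ N)
    p/ε<N = ≤-<-trans (≤-numerator (p * 1/ ε)) (fromℤ-mono-< (ℤ.+<+ ℕ.≤-refl))
    p/ε*ε≡p : p * 1/ ε * ε ≡ p
    p/ε*ε≡p = trans (*-assoc p (1/ ε) ε) (trans (cong (p *_) (*-inverseˡ ε)) (*-identityʳ p))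

  pow≤1 : ∀ {r} → 0ℚ ≤ r → r ≤ 1ℚ → ∀ n → r ^ n ≤ 1ℚ
  pow≤1 0≤r r≤1 zero    = ≤-refl
  pow≤1 {r} 0≤r r≤1 (suc n) = 0≤q-p⇒p≤q (subst (0ℚ ≤_) (sym (identity r (r ^ n)))
    (nonNeg+nonNeg (p≤q⇒0≤q-p r≤1) (nonNeg*nonNeg 0≤r (p≤q⇒0≤q-p (pow≤1 0≤r r≤1 n)))))
    where
    identity : ∀ r R → 1ℚ - r * R ≡ (1ℚ - r) + r * (1ℚ - R)
    identity = solve-∀ ℚ-ring

  bernoulli : ∀ {r} → 0ℚ ≤ r → r ≤ 1ℚ → ∀ n → r ^ n * (1ℚ + fromℤ (+ n) * (1ℚ - r)) ≤ 1ℚ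
  bernoulli {r} 0≤r r≤1 zero = ≤-reflexive (identity r)
    where
    identity : ∀ r → 1ℚ * (1ℚ + 0ℚ * (1ℚ - r)) ≡ 1ℚ
    identity = solve-∀ ℚ-ring
  bernoulli {r} 0≤r r≤1 (suc n) = 0≤q-p⇒p≤q (subst (0ℚ ≤_) (sym step)
    (nonNeg+nonNeg (nonNeg*nonNeg 0≤r (p≤q⇒0≤q-p (bernoulli 0≤r r≤1 n)))
                   (nonNeg*nonNeg (p≤q⇒0≤q-p r≤1) (p≤q⇒0≤q-p (pow≤1 0≤r r≤1 (suc n))))))
    where
    R = r ^ n
    N = fromℤ (+ n)
    identity : ∀ r R N → 1ℚ - r * R * (1ℚ + (1ℚ + N) * (1ℚ - r))
                       ≡ r * (1ℚ - R * (1ℚ + N * (1ℚ - r))) + (1ℚ - r) * (1ℚ - r * R)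
    identity = solve-∀ ℚ-ring
    step : 1ℚ - r * R * (1ℚ + fromℤ (+ suc n) * (1ℚ - r))
         ≡ r * (1ℚ - R * (1ℚ + N * (1ℚ - r))) + (1ℚ - r) * (1ℚ - r * R)
    step = trans (cong (λ t → 1ℚ - r * R * (1ℚ + t * (1ℚ - r))) (fromℤ-homo-+ (+ 1) (+ n))) (identity r R N)

  -- By Bernoulli, (ε − M rⁿ)(1 + n(1 − r)) ≥ ε + (n ε (1 − r) − M), which is positive once n ≥ N.
  geometric-decay : ∀ {r} → 0ℚ ≤ r → r < 1ℚ → ∀ M ε → 0ℚ ≤ M → 0ℚ < ε →
                    ∃ λ N → ∀ n → N ℕ.≤ n → M * r ^ n < ε
  geometric-decay {r} 0≤r r<1 M ε 0≤M 0<ε = N , decay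
    where
    q = 1ℚ - r
    0<q : 0ℚ < q
    0<q = p<q⇒0<q-p r<1
    0<εq : 0ℚ < ε * q
    0<εq = pos*pos 0<ε 0<q
    N = proj₁ (archimedean M (ε * q) 0<εq)
    identity : ∀ ε M R n q → (ε - M * R) * (1ℚ + n * q) ≡ ε + (n * (ε * q) - M) + M * (1ℚ - R * (1ℚ + n * q))
    identity = solve-∀ ℚ-ring
    decay : ∀ n → N ℕ.≤ n → M * r ^ n < ε
    decay n N≤n = 0<q-p⇒p<q (*-cancelʳ-<-nonNeg (1ℚ + fromℤ (+ n) * q) {{ℚ.nonNegative (<⇒≤ 0<1+nq)}}
      (subst₂ _<_ (sym (*-zeroˡ (1ℚ + fromℤ (+ n) * q))) (sym (identity ε M (r ^ n) (fromℤ (+ n)) q))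
        (pos+nonNeg (pos+pos 0<ε 0<nεq-M) (nonNeg*nonNeg 0≤M (p≤q⇒0≤q-p (bernoulli 0≤r (<⇒≤ r<1) n))))))
      where
      0≤n : 0ℚ ≤ fromℤ (+ n)
      0≤n = fromℤ-mono-≤ (ℤ.+≤+ z≤n)
      0<1+nq : 0ℚ < 1ℚ + fromℤ (+ n) * q
      0<1+nq = pos+nonNeg 0<1 (nonNeg*nonNeg 0≤n (<⇒≤ 0<q))
      0<nεq-M : 0ℚ < fromℤ (+ n) * (ε * q) - M
      0<nεq-M = p<q⇒0<q-p (<-≤-trans (proj₂ (archimedean M (ε * q) 0<εq))
                  (*-monoʳ-≤-nonNeg (ε * q) {{ℚ.nonNegative (<⇒≤ 0<εq)}} (fromℤ-mono-≤ (ℤ.+≤+ N≤n))))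

  *-zero-divisor : ∀ p q → p ≢ 0ℚ → p * q ≡ 0ℚ → q ≡ 0ℚ
  *-zero-divisor p q p≢0 pq≡0 = begin
    q               ≡⟨ *-identityˡ q ⟨
    1ℚ * q          ≡⟨ cong (_* q) (*-inverseˡ p) ⟨
    1/ p * p * q    ≡⟨ *-assoc (1/ p) p q ⟩
    1/ p * (p * q)  ≡⟨ cong (1/ p *_) pq≡0 ⟩
    1/ p * 0ℚ       ≡⟨ *-zeroʳ (1/ p) ⟩
    0ℚ              ∎
    where
    open ≡-Reasoning
    instance _ = ℚ.≢-nonZero p≢0

  halve : ∀ p q → p + p ≡ q + q → p ≡ q
  halve p q p+p≡q+q = begin
    p                  ≡⟨ lemma p ⟩
    (p + p) * ½        ≡⟨ cong (_* ½) p+p≡q+q ⟩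
    (q + q) * ½        ≡⟨ lemma q ⟨
    q                  ∎
    where
    open ≡-Reasoning
    ½ = + 1 / 2
    lemma : ∀ p → p ≡ (p + p) * ½
    lemma = solve-∀ ℚ-ring

  halve-2∣ : ∀ p w → p + p ≡ fromℤ w → (2∣w : + 2 ∣ w) → p ≡ fromℤ (_∣_.quotient 2∣w)
  halve-2∣ p w p+p≡w (divides k w≡2k) = halve p (fromℤ k) (begin
    p + p                   ≡⟨ p+p≡w ⟩
    fromℤ w                 ≡⟨ cong fromℤ w≡2k ⟩
    fromℤ (k ℤ.* + 2)       ≡⟨ fromℤ-homo-* k (+ 2) ⟩
    fromℤ k * fromℤ (+ 2)   ≡⟨ lemma (fromℤ k) ⟩
    fromℤ k + fromℤ k       ∎)
    where
    open ≡-Reasoning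
    lemma : ∀ K → K * fromℤ (+ 2) ≡ K + K
    lemma = solve-∀ ℚ-ring

  reciprocal-not-integer : ∀ {n} q → 1 ℕ.< n → q * fromℤ (+ n) ≡ 1ℚ → ¬ IsInteger q
  reciprocal-not-integer {n} q 1<n qn≡1 (m , refl) = ℕ.<-irrefl (sym n≡1) 1<n
    where
    mn≡1 : m ℤ.* + n ≡ + 1
    mn≡1 = fromℤ-injective (trans (fromℤ-homo-* m (+ n)) qn≡1)
    n≡1 : n ≡ 1
    n≡1 = ℕ.m*n≡1⇒n≡1 ℤ.∣ m ∣ n (trans (sym (ℤ.abs-* m (+ n))) (cong ℤ.∣_∣ mn≡1))

  0<a⇒b²<a²⇒0<a+b : ∀ {a b} → 0ℚ < a → 0ℚ < a * a - b * b → 0ℚ < a + b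
  0<a⇒b²<a²⇒0<a+b {a} {b} 0<a 0<a²-b² with 0ℚ <? a + b
  ... | yes 0<a+b = 0<a+b
  ... | no 0≮a+b = ⊥-elim (<-irrefl refl (<-≤-trans 0<a²-b² (0≤q-p⇒p≤q (subst (0ℚ ≤_) (identity₁ a b) 0≤-[a²-b²]))))
    where
    identity₁ : ∀ a b → - (a + b) * (a - b) ≡ 0ℚ - (a * a - b * b)
    identity₁ = solve-∀ ℚ-ring
    identity₂ : ∀ a b → a - b ≡ (a + a) + - (a + b)
    identity₂ = solve-∀ ℚ-ring
    0≤-[a+b] : 0ℚ ≤ - (a + b)
    0≤-[a+b] = neg-antimono-≤ (≮⇒≥ 0≮a+b)
    0≤-[a²-b²] : 0ℚ ≤ - (a + b) * (a - b)
    0≤-[a²-b²] = nonNeg*nonNeg 0≤-[a+b] (subst (0ℚ ≤_) (sym (identity₂ a b)) (nonNeg+nonNeg (<⇒≤ (pos+pos 0<a 0<a)) 0≤-[a+b]))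

open Rationals

module SquaresMod4 where

  open import Data.Integer using (_+_; _-_; _*_)

  parity : ∀ u → (+ 2 ∣ u) ⊎ (+ 2 ∣ u - + 1)
  parity u with u ℤ.%ℕ 2 | ℤ.a≡a%ℕn+[a/ℕn]*n u 2 | ℤ.n%ℕd<d u 2
  ... | 0           | u≡ | _ = inj₁ (divides (u ℤ./ℕ 2) (trans u≡ (ℤ.+-identityˡ _)))
  ... | 1           | u≡ | _ = inj₂ (divides (u ℤ./ℕ 2) (trans (cong (_- + 1) u≡) (lemma (u ℤ./ℕ 2))))
    where
    lemma : ∀ i → + 1 + i * + 2 - + 1 ≡ i * + 2
    lemma = ℤ-Solver.solve-∀
  ... | suc (suc _) | _  | s≤s (s≤s ())

  square-residue : ∀ u → Σ ℤ λ a → (a ≡ + 0 ⊎ a ≡ + 1) × + 2 ∣ u - a × + 4 ∣ u * u - a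
  square-residue u with parity u
  ... | inj₁ (divides i u≡2i) = + 0 , inj₁ refl , divides i (trans (ℤ.+-identityʳ u) u≡2i) ,
    divides (i * i) (trans (cong (λ t → t * t - + 0) u≡2i) (lemma i))
    where
    lemma : ∀ i → i * + 2 * (i * + 2) - + 0 ≡ i * i * + 4
    lemma = ℤ-Solver.solve-∀
  ... | inj₂ (divides i u-1≡2i) = + 1 , inj₂ refl , divides i u-1≡2i ,
    divides (i * i + i) (trans (lemma₁ u) (trans (cong (λ t → (t + + 1) * (t + + 1) - + 1) u-1≡2i) (lemma₂ i)))
    where
    lemma₁ : ∀ u → u * u - + 1 ≡ (u - + 1 + + 1) * (u - + 1 + + 1) - + 1
    lemma₁ = ℤ-Solver.solve-∀
    lemma₂ : ∀ i → (i * + 2 + + 1) * (i * + 2 + + 1) - + 1 ≡ (i * i + i) * + 4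
    lemma₂ = ℤ-Solver.solve-∀

  private
    4∤ : ∀ δ {_ : False (+ 4 ∣? δ)} → ¬ (+ 4 ∣ δ)
    4∤ δ {4∤δ} = toWitnessFalse 4∤δ

    2∣-same-residue : ∀ u v a → + 2 ∣ u - a → + 2 ∣ v - a → + 2 ∣ u - v
    2∣-same-residue u v a 2∣u-a 2∣v-a = subst (+ 2 ∣_) (lemma u v a) (∣m∣n⇒∣m-n 2∣u-a 2∣v-a)
      where
      lemma : ∀ u v a → u - a - (v - a) ≡ u - v
      lemma = ℤ-Solver.solve-∀

    4∣n-n%4 : ∀ n → + 4 ∣ + n - + (n ℕ.% 4)
    4∣n-n%4 n = divides (+ (n ℕ./ 4)) (begin
      + n - + r                        ≡⟨ cong (λ t → + t - + r) (ℕ.m≡m%n+[m/n]*n n 4) ⟩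
      + (r ℕ.+ n ℕ./ 4 ℕ.* 4) - + r    ≡⟨ cong (_- + r) (ℤ.pos-+ r (n ℕ./ 4 ℕ.* 4)) ⟩
      + r + + (n ℕ./ 4 ℕ.* 4) - + r    ≡⟨ lemma (+ r) (+ (n ℕ./ 4 ℕ.* 4)) ⟩
      + (n ℕ./ 4 ℕ.* 4)                ≡⟨ ℤ.pos-* (n ℕ./ 4) 4 ⟩
      + (n ℕ./ 4) * + 4                ∎)
      where
      open ≡-Reasoning
      r = n ℕ.% 4
      lemma : ∀ r m → r + m - r ≡ m
      lemma = ℤ-Solver.solve-∀

    -- With u ≡ a, v ≡ b (mod 2) and n ≡ r (mod 4):  u² - n v² ≡ a - r b (mod 4).
    reduce-mod4 : ∀ n u v → + 4 ∣ u * u - + n * (v * v) →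
             Σ ℤ λ a → Σ ℤ λ b → (a ≡ + 0 ⊎ a ≡ + 1) × (b ≡ + 0 ⊎ b ≡ + 1) ×
             + 2 ∣ u - a × + 2 ∣ v - b × + 4 ∣ a - + (n ℕ.% 4) * b
    reduce-mod4 n u v 4∣u²-nv² with square-residue u | square-residue v
    ... | a , a∈ , 2∣u-a , 4∣u²-a | b , b∈ , 2∣v-b , 4∣v²-b =
      a , b , a∈ , b∈ , 2∣u-a , 2∣v-b ,
      subst (+ 4 ∣_) (sym (lemma u v a b (+ n) (+ (n ℕ.% 4))))
        (∣m∣n⇒∣m+n (∣m∣n⇒∣m-n 4∣u²-nv² 4∣u²-a)
                   (∣m∣n⇒∣m+n (∣n⇒∣m*n (+ n) 4∣v²-b) (∣n⇒∣m*n b (4∣n-n%4 n))))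
      where
      lemma : ∀ u v a b n r → a - r * b ≡ (u * u - n * (v * v) - (u * u - a)) + (n * (v * v - b) + b * (n - r))
      lemma = ℤ-Solver.solve-∀

  mod4≡1⇒2∣u-v : ∀ n → n ℕ.% 4 ≡ 1 → ∀ u v → + 4 ∣ u * u - + n * (v * v) → + 2 ∣ u - v
  mod4≡1⇒2∣u-v n n%4≡1 u v 4∣u²-nv² with reduce-mod4 n u v 4∣u²-nv²
  ... | a , b , a∈ , b∈ , 2∣u-a , 2∣v-b , 4∣a-rb rewrite n%4≡1 with a∈ | b∈
  ...   | inj₁ refl | inj₁ refl = 2∣-same-residue u v (+ 0) 2∣u-a 2∣v-b
  ...   | inj₂ refl | inj₂ refl = 2∣-same-residue u v (+ 1) 2∣u-a 2∣v-b
  ...   | inj₁ refl | inj₂ refl = ⊥-elim (4∤ _ 4∣a-rb)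
  ...   | inj₂ refl | inj₁ refl = ⊥-elim (4∤ _ 4∣a-rb)

  mod4≡2,3⇒even : ∀ n → n ℕ.% 4 ≡ 2 ⊎ n ℕ.% 4 ≡ 3 → ∀ u v → + 4 ∣ u * u - + n * (v * v) → + 2 ∣ u × + 2 ∣ v
  mod4≡2,3⇒even n n%4∈ u v 4∣u²-nv² with reduce-mod4 n u v 4∣u²-nv²
  ... | a , b , a∈ , b∈ , 2∣u-a , 2∣v-b , 4∣a-rb with n ℕ.% 4 | n%4∈ | a∈ | b∈
  ...   | _ | _         | inj₁ refl | inj₁ refl =
    subst (+ 2 ∣_) (ℤ.+-identityʳ u) 2∣u-a , subst (+ 2 ∣_) (ℤ.+-identityʳ v) 2∣v-b
  ...   | 2 | inj₁ refl | inj₁ refl | inj₂ refl = ⊥-elim (4∤ _ 4∣a-rb)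
  ...   | 2 | inj₁ refl | inj₂ refl | inj₁ refl = ⊥-elim (4∤ _ 4∣a-rb)
  ...   | 2 | inj₁ refl | inj₂ refl | inj₂ refl = ⊥-elim (4∤ _ 4∣a-rb)
  ...   | 3 | inj₂ refl | inj₁ refl | inj₂ refl = ⊥-elim (4∤ _ 4∣a-rb)
  ...   | 3 | inj₂ refl | inj₂ refl | inj₁ refl = ⊥-elim (4∤ _ 4∣a-rb)
  ...   | 3 | inj₂ refl | inj₂ refl | inj₂ refl = ⊥-elim (4∤ _ 4∣a-rb)

open SquaresMod4

module QuadraticRing (d : ℕ) where

  open Arith d
  open import Data.Rational using (_+_; _*_; _-_; -_)

  private
    D = ℚof d
    *-assoc-re : ∀ D a b c e f g → (a * c + D * b * e) * f + D * (a * e + b * c) * g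
                                 ≡ a * (c * f + D * e * g) + D * b * (c * g + e * f)
    *-assoc-re = solve-∀ ℚ-ring
    *-assoc-im : ∀ D a b c e f g → (a * c + D * b * e) * g + (a * e + b * c) * f
                                 ≡ a * (c * g + e * f) + b * (c * f + D * e * g)
    *-assoc-im = solve-∀ ℚ-ring
    *-comm-re : ∀ D a b c e → a * c + D * b * e ≡ c * a + D * e * b
    *-comm-re = solve-∀ ℚ-ring
    *-comm-im : ∀ a b c e → a * e + b * c ≡ c * b + e * a
    *-comm-im = solve-∀ ℚ-ring
    *-identityˡ-re : ∀ D a b → 1ℚ * a + D * 0ℚ * b ≡ a
    *-identityˡ-re = solve-∀ ℚ-ring
    *-identityˡ-im : ∀ a b → 1ℚ * b + 0ℚ * a ≡ b
    *-identityˡ-im = solve-∀ ℚ-ring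
    *-distribˡ-re : ∀ D a b c e f g → a * (c + f) + D * b * (e + g) ≡ (a * c + D * b * e) + (a * f + D * b * g)
    *-distribˡ-re = solve-∀ ℚ-ring
    *-distribˡ-im : ∀ a b c e f g → a * (e + g) + b * (c + f) ≡ (a * e + b * c) + (a * g + b * f)
    *-distribˡ-im = solve-∀ ℚ-ring

  +K-assoc : ∀ x y z → (x +K y) +K z ≡ x +K (y +K z)
  +K-assoc ⟨ a , b ⟩ ⟨ c , e ⟩ ⟨ f , g ⟩ = cong₂ ⟨_,_⟩ (+-assoc a c f) (+-assoc b e g)

  +K-comm : ∀ x y → x +K y ≡ y +K x
  +K-comm ⟨ a , b ⟩ ⟨ c , e ⟩ = cong₂ ⟨_,_⟩ (+-comm a c) (+-comm b e)

  +K-identityˡ : ∀ x → 0K +K x ≡ x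
  +K-identityˡ ⟨ a , b ⟩ = cong₂ ⟨_,_⟩ (+-identityˡ a) (+-identityˡ b)

  +K-identityʳ : ∀ x → x +K 0K ≡ x
  +K-identityʳ ⟨ a , b ⟩ = cong₂ ⟨_,_⟩ (+-identityʳ a) (+-identityʳ b)

  +K-inverseˡ : ∀ x → -K x +K x ≡ 0K
  +K-inverseˡ ⟨ a , b ⟩ = cong₂ ⟨_,_⟩ (+-inverseˡ a) (+-inverseˡ b)

  +K-inverseʳ : ∀ x → x +K -K x ≡ 0K
  +K-inverseʳ ⟨ a , b ⟩ = cong₂ ⟨_,_⟩ (+-inverseʳ a) (+-inverseʳ b)

  *K-assoc : ∀ x y z → (x *K y) *K z ≡ x *K (y *K z)
  *K-assoc ⟨ a , b ⟩ ⟨ c , e ⟩ ⟨ f , g ⟩ = cong₂ ⟨_,_⟩ (*-assoc-re D a b c e f g) (*-assoc-im D a b c e f g)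

  *K-comm : ∀ x y → x *K y ≡ y *K x
  *K-comm ⟨ a , b ⟩ ⟨ c , e ⟩ = cong₂ ⟨_,_⟩ (*-comm-re D a b c e) (*-comm-im a b c e)

  *K-identityˡ : ∀ x → 1K *K x ≡ x
  *K-identityˡ ⟨ a , b ⟩ = cong₂ ⟨_,_⟩ (*-identityˡ-re D a b) (*-identityˡ-im a b)

  *K-distribˡ : ∀ x y z → x *K (y +K z) ≡ x *K y +K x *K z
  *K-distribˡ ⟨ a , b ⟩ ⟨ c , e ⟩ ⟨ f , g ⟩ = cong₂ ⟨_,_⟩ (*-distribˡ-re D a b c e f g) (*-distribˡ-im a b c e f g)

  +K-*K-isCommutativeRing : IsCommutativeRing _≡_ _+K_ _*K_ -K_ 0K 1K
  +K-*K-isCommutativeRing = record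
    { isRing = record
      { +-isAbelianGroup = record
        { isGroup = record
          { isMonoid = record
            { isSemigroup = record
              { isMagma = record { isEquivalence = isEquivalence ; ∙-cong = cong₂ _+K_ }
              ; assoc = +K-assoc }
            ; identity = +K-identityˡ , +K-identityʳ }
          ; inverse = +K-inverseˡ , +K-inverseʳ
          ; ⁻¹-cong = cong (λ x → -K x) }
        ; comm = +K-comm }
      ; *-cong = cong₂ _*K_
      ; *-assoc = *K-assoc
      ; *-identity = *K-identityˡ , λ x → trans (*K-comm x 1K) (*K-identityˡ x)
      ; distrib = *K-distribˡ , λ x y z → trans (*K-comm (y +K z) x)
                    (trans (*K-distribˡ x y z) (cong₂ _+K_ (*K-comm x y) (*K-comm x z))) }
    ; *-comm = *K-comm }

  +K-*K-commutativeRing : CommutativeRing _ _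
  +K-*K-commutativeRing = record { isCommutativeRing = +K-*K-isCommutativeRing }

  ι-homo-* : ∀ p q → ι (p * q) ≡ ι p *K ι q
  ι-homo-* p q = cong₂ ⟨_,_⟩ (sym (lemma-re D p q)) (sym (lemma-im p q))
    where
    lemma-re : ∀ D p q → p * q + D * 0ℚ * 0ℚ ≡ p * q
    lemma-re = solve-∀ ℚ-ring
    lemma-im : ∀ p q → p * 0ℚ + 0ℚ * q ≡ 0ℚ
    lemma-im = solve-∀ ℚ-ring

  ιℤ≡ι∘fromℤ : ∀ m → ιℤ m ≡ ι (fromℤ m)
  ιℤ≡ι∘fromℤ m = cong ι (m/1≡fromℤ m)

  ιℤ-homo-+ : ∀ m n → ιℤ (m ℤ.+ n) ≡ ιℤ m +K ιℤ n
  ιℤ-homo-+ m n = begin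
    ιℤ (m ℤ.+ n)                    ≡⟨ ιℤ≡ι∘fromℤ (m ℤ.+ n) ⟩
    ι (fromℤ (m ℤ.+ n))             ≡⟨ cong ι (fromℤ-homo-+ m n) ⟩
    ι (fromℤ m) +K ι (fromℤ n)      ≡⟨ cong₂ _+K_ (ιℤ≡ι∘fromℤ m) (ιℤ≡ι∘fromℤ n) ⟨
    ιℤ m +K ιℤ n                    ∎
    where open ≡-Reasoning

  ιℤ-homo-* : ∀ m n → ιℤ (m ℤ.* n) ≡ ιℤ m *K ιℤ n
  ιℤ-homo-* m n = begin
    ιℤ (m ℤ.* n)                    ≡⟨ ιℤ≡ι∘fromℤ (m ℤ.* n) ⟩
    ι (fromℤ (m ℤ.* n))             ≡⟨ cong ι (fromℤ-homo-* m n) ⟩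
    ι (fromℤ m * fromℤ n)           ≡⟨ ι-homo-* (fromℤ m) (fromℤ n) ⟩
    ι (fromℤ m) *K ι (fromℤ n)      ≡⟨ cong₂ _*K_ (ιℤ≡ι∘fromℤ m) (ιℤ≡ι∘fromℤ n) ⟨
    ιℤ m *K ιℤ n                    ∎
    where open ≡-Reasoning

  ιℤ-homo‿- : ∀ m → ιℤ (ℤ.- m) ≡ -K ιℤ m
  ιℤ-homo‿- m = begin
    ιℤ (ℤ.- m)                      ≡⟨ ιℤ≡ι∘fromℤ (ℤ.- m) ⟩
    ι (fromℤ (ℤ.- m))               ≡⟨ cong ι (fromℤ-homo‿- m) ⟩
    -K ι (fromℤ m)                  ≡⟨ cong -K_ (ιℤ≡ι∘fromℤ m) ⟨
    -K ιℤ m                         ∎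
    where open ≡-Reasoning

  ιℤ-morphism : CommutativeRing.rawRing ℤ.+-*-commutativeRing
                ACR.-Raw-AlmostCommutative⟶ ACR.fromCommutativeRing +K-*K-commutativeRing
  ιℤ-morphism = record
    { ⟦_⟧ = ιℤ ; +-homo = ιℤ-homo-+ ; *-homo = ιℤ-homo-* ; -‿homo = ιℤ-homo‿- ; 0-homo = refl ; 1-homo = refl }

  module K-Solver = Algebra.Solver.Ring (CommutativeRing.rawRing ℤ.+-*-commutativeRing)
    (ACR.fromCommutativeRing +K-*K-commutativeRing) ιℤ-morphism
    (λ m n → Maybe.map (cong ιℤ) (dec⇒maybe (m ℤ.≟ n)))

  σ-homo-+ : ∀ x y → σ (x +K y) ≡ σ x +K σ y
  σ-homo-+ ⟨ a , b ⟩ ⟨ c , e ⟩ = cong ⟨ a + c ,_⟩ (neg-distrib-+ b e)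

  σ-homo-* : ∀ x y → σ (x *K y) ≡ σ x *K σ y
  σ-homo-* ⟨ a , b ⟩ ⟨ c , e ⟩ = cong₂ ⟨_,_⟩ (lemma-re D a b c e) (lemma-im a b c e)
    where
    lemma-re : ∀ D a b c e → a * c + D * b * e ≡ a * c + D * (- b) * (- e)
    lemma-re = solve-∀ ℚ-ring
    lemma-im : ∀ a b c e → - (a * e + b * c) ≡ a * (- e) + (- b) * c
    lemma-im = solve-∀ ℚ-ring

  σ-homo-^ : ∀ x n → σ (x ^K n) ≡ σ x ^K n
  σ-homo-^ x zero    = refl
  σ-homo-^ x (suc n) = trans (σ-homo-* x (x ^K n)) (cong (σ x *K_) (σ-homo-^ x n))

module RealEmbedding (d : ℕ) (1<d : 1 ℕ.< d) (sf : SquareFree d) where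

  open Arith d
  open QuadraticRing d
  open import Data.Rational using (_+_; _*_; _-_; -_; _<_; _≤_; _⊓_)
  open K-Solver using (solve; _:+_; _:*_; :-_; _:-_; con; _:=_)

  private
    D = ℚof d

  1<D : 1ℚ < D
  1<D = subst (1ℚ <_) (sym (m/1≡fromℤ (+ d))) (fromℤ-mono-< (ℤ.+<+ 1<d))

  0<D : 0ℚ < D
  0<D = <-trans 0<1 1<D

  -- A rational square root of d would be a rational root of X² - d, hence an integer.
  √d-irrational : ∀ x y → x * x ≡ D * (y * y) → y ≡ 0ℚ
  √d-irrational x y x²≡dy² with y ≟ 0ℚ
  ... | yes y≡0 = y≡0
  ... | no y≢0 = ⊥-elim (ℕ.<-irrefl (sym d≡1) 1<d)
    where
    instance _ = ℚ.≢-nonZero y≢0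
    X = x * 1/ y
    identity : ∀ x i → (x * i) * (x * i) ≡ (x * x) * (i * i)
    identity = solve-∀ ℚ-ring
    identity′ : ∀ D y i → D * (y * y) * (i * i) ≡ D * ((y * i) * (y * i))
    identity′ = solve-∀ ℚ-ring
    X²≡D : X * X ≡ D
    X²≡D = begin
      X * X                          ≡⟨ identity x (1/ y) ⟩
      x * x * (1/ y * 1/ y)          ≡⟨ cong (_* (1/ y * 1/ y)) x²≡dy² ⟩
      D * (y * y) * (1/ y * 1/ y)    ≡⟨ identity′ D y (1/ y) ⟩
      D * ((y * 1/ y) * (y * 1/ y))  ≡⟨ cong (λ t → D * (t * t)) (*-inverseʳ y) ⟩
      D * (1ℚ * 1ℚ)                  ≡⟨ *-identityʳ D ⟩
      D                              ∎
      where open ≡-Reasoning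
    X-root : X * X + fromℤ (+ 0) * X + fromℤ (ℤ.- + d) ≡ 0ℚ
    X-root = trans (cong₂ (λ s t → s + 0ℚ * X + t) X²≡D (trans (fromℤ-homo‿- (+ d)) (cong -_ (sym (m/1≡fromℤ (+ d))))))
                   (lemma D X)
      where
      lemma : ∀ D X → D + 0ℚ * X + - D ≡ 0ℚ
      lemma = solve-∀ ℚ-ring
    root = monic-root-isInteger (+ 0) (ℤ.- + d) X X-root
    m = proj₁ root
    m*m≡d : m ℤ.* m ≡ + d
    m*m≡d = fromℤ-injective (begin
      fromℤ (m ℤ.* m)   ≡⟨ fromℤ-homo-* m m ⟩
      fromℤ m * fromℤ m ≡⟨ cong (λ t → t * t) (proj₂ root) ⟨
      X * X             ≡⟨ X²≡D ⟩
      D                 ≡⟨ m/1≡fromℤ (+ d) ⟩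
      fromℤ (+ d)       ∎)
      where open ≡-Reasoning
    ∣m∣²≡d : ℤ.∣ m ∣ ℕ.* ℤ.∣ m ∣ ≡ d
    ∣m∣²≡d = trans (sym (ℤ.abs-* m m)) (cong ℤ.∣_∣ m*m≡d)
    ∣m∣≡1 : ℤ.∣ m ∣ ≡ 1
    ∣m∣≡1 = sf ℤ.∣ m ∣ (ℕ.divides 1 (trans (sym ∣m∣²≡d) (sym (ℕ.*-identityˡ _))))
    d≡1 : d ≡ 1
    d≡1 = trans (sym ∣m∣²≡d) (cong (λ t → t ℕ.* t) ∣m∣≡1)

  -- x + y√d > 0, split by which of |x| and |y|√d is larger (they are never equal unless both vanish).
  data IsPositive : K → Set where
    re-dominant : ∀ {x y} → 0ℚ < x → 0ℚ < x * x - D * y * y → IsPositive ⟨ x , y ⟩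
    im-dominant : ∀ {x y} → 0ℚ < y → 0ℚ < D * y * y - x * x → IsPositive ⟨ x , y ⟩

  isPositive⇒Pos : ∀ z → IsPositive z → Pos z
  isPositive⇒Pos ⟨ x , y ⟩ (re-dominant 0<x 0<N) with 0ℚ ≤? y
  ... | yes 0≤y = inj₁ (<⇒≤ 0<x , 0≤y , inj₁ 0<x)
  ... | no  0≰y = inj₂ (inj₁ (0<x , ≰⇒> 0≰y , 0<q-p⇒p<q 0<N))
  isPositive⇒Pos ⟨ x , y ⟩ (im-dominant 0<y 0<M) with 0ℚ ≤? x
  ... | yes 0≤x = inj₁ (0≤x , <⇒≤ 0<y , inj₂ 0<y)
  ... | no  0≰x = inj₂ (inj₂ (≰⇒> 0≰x , 0<y , 0<q-p⇒p<q 0<M))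

  private
    nonNeg∧square-pos⇒pos : ∀ {p} → 0ℚ ≤ p → 0ℚ < p * p → 0ℚ < p
    nonNeg∧square-pos⇒pos {p} 0≤p 0<p² with 0ℚ <? p
    ... | yes 0<p = 0<p
    ... | no 0≮p with ≤-antisym 0≤p (≮⇒≥ 0≮p)
    ...   | refl = ⊥-elim (<-irrefl refl 0<p²)

    square≡0⇒≡0 : ∀ p → p * p ≡ 0ℚ → p ≡ 0ℚ
    square≡0⇒≡0 p p²≡0 with p ≟ 0ℚ
    ... | yes p≡0 = p≡0
    ... | no p≢0 = ⊥-elim (<-irrefl (sym p²≡0) (square-pos p≢0))

  Pos⇒isPositive : ∀ z → Pos z → IsPositive z
  Pos⇒isPositive ⟨ x , y ⟩ (inj₂ (inj₁ (0<x , _ , dy²<x²))) = re-dominant 0<x (p<q⇒0<q-p dy²<x²)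
  Pos⇒isPositive ⟨ x , y ⟩ (inj₂ (inj₂ (_ , 0<y , x²<dy²))) = im-dominant 0<y (p<q⇒0<q-p x²<dy²)
  Pos⇒isPositive ⟨ x , y ⟩ (inj₁ (0≤x , 0≤y , 0<x⊎0<y)) with <-cmp (D * y * y) (x * x)
  ... | tri< dy²<x² _ _ = re-dominant (nonNeg∧square-pos⇒pos 0≤x (≤-<-trans 0≤dy² dy²<x²)) (p<q⇒0<q-p dy²<x²)
    where
    0≤dy² : 0ℚ ≤ D * y * y
    0≤dy² = subst (0ℚ ≤_) (sym (*-assoc D y y)) (nonNeg*nonNeg (<⇒≤ 0<D) (square-nonNeg y))
  ... | tri> _ _ x²<dy² = im-dominant (nonNeg∧square-pos⇒pos 0≤y 0<y²) (p<q⇒0<q-p x²<dy²)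
    where
    0<y² : 0ℚ < y * y
    0<y² = *-cancelˡ-<-nonNeg D {{ℚ.nonNegative (<⇒≤ 0<D)}}
             (subst₂ _<_ (sym (*-zeroʳ D)) (*-assoc D y y) (≤-<-trans (square-nonNeg x) x²<dy²))
  ... | tri≈ _ dy²≡x² _ = ⊥-elim (both-zero 0<x⊎0<y)
    where
    y≡0 : y ≡ 0ℚ
    y≡0 = √d-irrational x y (trans (sym dy²≡x²) (*-assoc D y y))
    x≡0 : x ≡ 0ℚ
    x≡0 = square≡0⇒≡0 x (trans (sym dy²≡x²) (trans (cong (λ t → D * t * t) y≡0) (*-zeroʳ (D * 0ℚ))))
    both-zero : ¬ (0ℚ < x ⊎ 0ℚ < y)
    both-zero (inj₁ 0<x) = <-irrefl (sym x≡0) 0<x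
    both-zero (inj₂ 0<y) = <-irrefl (sym y≡0) 0<y

  private
    0≤dy² : ∀ y → 0ℚ ≤ D * (y * y)
    0≤dy² y = nonNeg*nonNeg (<⇒≤ 0<D) (square-nonNeg y)

    norm-* : ∀ D x₁ y₁ x₂ y₂ →
               (x₁ * x₂ + D * y₁ * y₂) * (x₁ * x₂ + D * y₁ * y₂) - D * (x₁ * y₂ + y₁ * x₂) * (x₁ * y₂ + y₁ * x₂)
             ≡ (x₁ * x₁ - D * y₁ * y₁) * (x₂ * x₂ - D * y₂ * y₂)
    norm-* = solve-∀ ℚ-ring
    -norm-* : ∀ D x₁ y₁ x₂ y₂ →
                D * (x₁ * y₂ + y₁ * x₂) * (x₁ * y₂ + y₁ * x₂) - (x₁ * x₂ + D * y₁ * y₂) * (x₁ * x₂ + D * y₁ * y₂)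
              ≡ (x₁ * x₁ - D * y₁ * y₁) * (D * y₂ * y₂ - x₂ * x₂)
    -norm-* = solve-∀ ℚ-ring
    norm-*′ : ∀ D x₁ y₁ x₂ y₂ →
                (x₁ * x₂ + D * y₁ * y₂) * (x₁ * x₂ + D * y₁ * y₂) - D * (x₁ * y₂ + y₁ * x₂) * (x₁ * y₂ + y₁ * x₂)
              ≡ (D * y₁ * y₁ - x₁ * x₁) * (D * y₂ * y₂ - x₂ * x₂)
    norm-*′ = solve-∀ ℚ-ring
    dominance₁ : ∀ D x₁ y₁ x₂ y₂ → (x₁ * x₂) * (x₁ * x₂) - (D * y₁ * y₂) * (D * y₁ * y₂)
                                 ≡ (x₁ * x₁ - D * y₁ * y₁) * (x₂ * x₂) + D * (y₁ * y₁) * (x₂ * x₂ - D * y₂ * y₂)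
    dominance₁ = solve-∀ ℚ-ring
    dominance₂ : ∀ D x₁ y₁ x₂ y₂ → (x₁ * y₂) * (x₁ * y₂) - (y₁ * x₂) * (y₁ * x₂)
                                 ≡ (x₁ * x₁ - D * y₁ * y₁) * (y₂ * y₂) + (y₁ * y₁) * (D * y₂ * y₂ - x₂ * x₂)
    dominance₂ = solve-∀ ℚ-ring
    dominance₃ : ∀ D x₁ y₁ x₂ y₂ → (D * y₁ * y₂) * (D * y₁ * y₂) - (x₁ * x₂) * (x₁ * x₂)
                                 ≡ (D * y₁ * y₁ - x₁ * x₁) * (D * (y₂ * y₂)) + (x₁ * x₁) * (D * y₂ * y₂ - x₂ * x₂)
    dominance₃ = solve-∀ ℚ-ring

  isPositive-* : ∀ a b → IsPositive a → IsPositive b → IsPositive (a *K b)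
  isPositive-* ⟨ x₁ , y₁ ⟩ ⟨ x₂ , y₂ ⟩ (re-dominant 0<x₁ 0<N₁) (re-dominant 0<x₂ 0<N₂) = re-dominant
    (0<a⇒b²<a²⇒0<a+b (pos*pos 0<x₁ 0<x₂) (subst (0ℚ <_) (sym (dominance₁ D x₁ y₁ x₂ y₂))
        (pos+nonNeg (pos*pos 0<N₁ (pos*pos 0<x₂ 0<x₂)) (nonNeg*nonNeg (0≤dy² y₁) (<⇒≤ 0<N₂)))))
    (subst (0ℚ <_) (sym (norm-* D x₁ y₁ x₂ y₂)) (pos*pos 0<N₁ 0<N₂))
  isPositive-* ⟨ x₁ , y₁ ⟩ ⟨ x₂ , y₂ ⟩ (re-dominant 0<x₁ 0<N₁) (im-dominant 0<y₂ 0<M₂) = im-dominant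
    (0<a⇒b²<a²⇒0<a+b (pos*pos 0<x₁ 0<y₂) (subst (0ℚ <_) (sym (dominance₂ D x₁ y₁ x₂ y₂))
        (pos+nonNeg (pos*pos 0<N₁ (pos*pos 0<y₂ 0<y₂)) (nonNeg*nonNeg (square-nonNeg y₁) (<⇒≤ 0<M₂)))))
    (subst (0ℚ <_) (sym (-norm-* D x₁ y₁ x₂ y₂)) (pos*pos 0<N₁ 0<M₂))
  isPositive-* a b 0<a@(im-dominant _ _) 0<b@(re-dominant _ _) =
    subst IsPositive (*K-comm b a) (isPositive-* b a 0<b 0<a)
  isPositive-* ⟨ x₁ , y₁ ⟩ ⟨ x₂ , y₂ ⟩ (im-dominant 0<y₁ 0<M₁) (im-dominant 0<y₂ 0<M₂) = re-dominant
    (subst (0ℚ <_) (+-comm (D * y₁ * y₂) (x₁ * x₂))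
        (0<a⇒b²<a²⇒0<a+b (pos*pos (pos*pos 0<D 0<y₁) 0<y₂) (subst (0ℚ <_) (sym (dominance₃ D x₁ y₁ x₂ y₂))
          (pos+nonNeg (pos*pos 0<M₁ (pos*pos 0<D (pos*pos 0<y₂ 0<y₂))) (nonNeg*nonNeg (square-nonNeg x₁) (<⇒≤ 0<M₂))))))
    (subst (0ℚ <_) (sym (norm-*′ D x₁ y₁ x₂ y₂)) (pos*pos 0<M₁ 0<M₂))

  isPositive-ι : ∀ {q} → 0ℚ < q → IsPositive (ι q)
  isPositive-ι {q} 0<q = re-dominant 0<q (subst (0ℚ <_) (sym (lemma D q)) (pos*pos 0<q 0<q))
    where
    lemma : ∀ D q → q * q - D * 0ℚ * 0ℚ ≡ q * q
    lemma = solve-∀ ℚ-ring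

  isPositive-ι⁻¹ : ∀ {q} → IsPositive (ι q) → 0ℚ < q
  isPositive-ι⁻¹ (re-dominant 0<q _) = 0<q
  isPositive-ι⁻¹ (im-dominant 0<0 _) = ⊥-elim (<-irrefl refl 0<0)

  -- The multiplier is the conjugate ±σ a; the product is ± the norm of a.
  positive-rational-multiple : ∀ a → IsPositive a → Σ K λ v → Σ ℚ λ n → IsPositive v × 0ℚ < n × a *K v ≡ ι n
  positive-rational-multiple ⟨ x , y ⟩ (re-dominant 0<x 0<N) =
    ⟨ x , - y ⟩ , x * x - D * y * y ,
    re-dominant 0<x (subst (0ℚ <_) (lemma-N D x y) 0<N) , 0<N , cong₂ ⟨_,_⟩ (lemma-re D x y) (lemma-im x y)
    where
    lemma-N : ∀ D x y → x * x - D * y * y ≡ x * x - D * (- y) * (- y)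
    lemma-N = solve-∀ ℚ-ring
    lemma-re : ∀ D x y → x * x + D * y * (- y) ≡ x * x - D * y * y
    lemma-re = solve-∀ ℚ-ring
    lemma-im : ∀ x y → x * (- y) + y * x ≡ 0ℚ
    lemma-im = solve-∀ ℚ-ring
  positive-rational-multiple ⟨ x , y ⟩ (im-dominant 0<y 0<M) =
    ⟨ - x , y ⟩ , D * y * y - x * x ,
    im-dominant 0<y (subst (0ℚ <_) (lemma-M D x y) 0<M) , 0<M , cong₂ ⟨_,_⟩ (lemma-re D x y) (lemma-im x y)
    where
    lemma-M : ∀ D x y → D * y * y - x * x ≡ D * y * y - (- x) * (- x)
    lemma-M = solve-∀ ℚ-ring
    lemma-re : ∀ D x y → x * (- x) + D * y * y ≡ D * y * y - x * x
    lemma-re = solve-∀ ℚ-ring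
    lemma-im : ∀ x y → x * y + y * (- x) ≡ 0ℚ
    lemma-im = solve-∀ ℚ-ring

  isPositive-1+ : ∀ w → IsPositive w → IsPositive (1K +K w)
  isPositive-1+ ⟨ x , y ⟩ (re-dominant 0<x 0<N) = re-dominant
    (pos+pos 0<1 0<x) (subst (0ℚ <_) (sym (lemma D x y)) (pos+pos 0<N (pos+pos 0<1 (pos+pos 0<x 0<x))))
    where
    lemma : ∀ D x y → (1ℚ + x) * (1ℚ + x) - D * (0ℚ + y) * (0ℚ + y) ≡ (x * x - D * y * y) + (1ℚ + (x + x))
    lemma = solve-∀ ℚ-ring
  isPositive-1+ ⟨ x , y ⟩ (im-dominant 0<y 0<M) with 0ℚ ≤? 1ℚ + x
  ... | yes 0≤1+x = Pos⇒isPositive ⟨ 1ℚ + x , 0ℚ + y ⟩ (inj₁ (0≤1+x , <⇒≤ 0<0+y , inj₂ 0<0+y))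
    where
    0<0+y : 0ℚ < 0ℚ + y
    0<0+y = subst (0ℚ <_) (sym (+-identityˡ y)) 0<y
  ... | no 0≰1+x = im-dominant (subst (0ℚ <_) (sym (+-identityˡ y)) 0<y)
      (subst (0ℚ <_) (sym (lemma D x y)) (pos+pos (pos+pos 0<M 0<-[1+x]) (pos+pos 0<-[1+x] 0<1)))
    where
    0<-[1+x] : 0ℚ < - (1ℚ + x)
    0<-[1+x] = neg-antimono-< (≰⇒> 0≰1+x)
    lemma : ∀ D x y → D * (0ℚ + y) * (0ℚ + y) - (1ℚ + x) * (1ℚ + x)
                    ≡ ((D * y * y - x * x) + - (1ℚ + x)) + (- (1ℚ + x) + 1ℚ)
    lemma = solve-∀ ℚ-ring

  -- a + b = a (1 + b v / n) where a v = n is the positive rational multiple of a.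
  isPositive-+ : ∀ a b → IsPositive a → IsPositive b → IsPositive (a +K b)
  isPositive-+ a b 0<a 0<b = subst IsPositive a[1+bv/n]≡a+b
    (isPositive-* a (1K +K b *K v *K ι (1/ n)) 0<a
      (isPositive-1+ _ (isPositive-* (b *K v) (ι (1/ n)) (isPositive-* b v 0<b 0<v) (isPositive-ι 0<1/n))))
    where
    multiple = positive-rational-multiple a 0<a
    v = proj₁ multiple
    n = proj₁ (proj₂ multiple)
    0<v = proj₁ (proj₂ (proj₂ multiple))
    0<n = proj₁ (proj₂ (proj₂ (proj₂ multiple)))
    av≡n = proj₂ (proj₂ (proj₂ (proj₂ multiple)))
    instance _ = pos⇒nonZero n {{ℚ.positive 0<n}}
    0<1/n : 0ℚ < 1/ n
    0<1/n = positive⁻¹ (1/ n) {{1/pos⇒pos n {{ℚ.positive 0<n}}}}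
    a[1+bv/n]≡a+b : a *K (1K +K b *K v *K ι (1/ n)) ≡ a +K b
    a[1+bv/n]≡a+b = begin
      a *K (1K +K b *K v *K ι (1/ n))
        ≡⟨ solve 4 (λ a b v i → a :* (con (+ 1) :+ b :* v :* i) := a :+ b :* (a :* v :* i)) refl a b v (ι (1/ n)) ⟩
      a +K b *K (a *K v *K ι (1/ n))
        ≡⟨ cong (λ t → a +K b *K (t *K ι (1/ n))) av≡n ⟩
      a +K b *K (ι n *K ι (1/ n))
        ≡⟨ cong (λ t → a +K b *K t) (trans (sym (ι-homo-* n (1/ n))) (cong ι (*-inverseʳ n))) ⟩
      a +K b *K 1K
        ≡⟨ solve 2 (λ a b → a :+ b :* con (+ 1) := a :+ b) refl a b ⟩
      a +K b ∎
      where open ≡-Reasoning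

  isPositive-half : ∀ z → IsPositive (z +K z) → IsPositive z
  isPositive-half z 0<2z = subst IsPositive z/2+z/2≡z (isPositive-* (ι ½) (z +K z) (isPositive-ι 0<½) 0<2z)
    where
    ½ = + 1 ℚ./ 2
    0<½ : 0ℚ < ½
    0<½ = ℚ.*<* (ℤ.+<+ (ℕ.s≤s ℕ.z≤n))
    z/2+z/2≡z : ι ½ *K (z +K z) ≡ z
    z/2+z/2≡z = trans (solve 2 (λ h z → h :* (z :+ z) := (h :+ h) :* z) refl (ι ½) z) (*K-identityˡ z)

  isPositive-+nonNeg : ∀ {q} a → IsPositive a → 0ℚ ≤ q → IsPositive (a +K ι q)
  isPositive-+nonNeg {q} a 0<a 0≤q with <-cmp 0ℚ q
  ... | tri< 0<q _ _ = isPositive-+ a (ι q) 0<a (isPositive-ι 0<q)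
  ... | tri≈ _ refl _ = subst IsPositive (sym (+K-identityʳ a)) 0<a
  ... | tri> _ _ q<0 = ⊥-elim (<-irrefl refl (<-≤-trans q<0 0≤q))

  record Bounded (r : ℚ) (z : K) : Set where
    constructor bounds
    field
      below : IsPositive (ι r -K z)
      above : IsPositive (ι r +K z)

  bounded⇒pos : ∀ {r z} → Bounded r z → 0ℚ < r
  bounded⇒pos {r} {z} (bounds 0<r-z 0<r+z) = isPositive-ι⁻¹ (isPositive-half (ι r) (subst IsPositive
    (solve 2 (λ r z → (r :- z) :+ (r :+ z) := r :+ r) refl (ι r) z) (isPositive-+ _ _ 0<r-z 0<r+z)))

  bounded-weaken : ∀ {r s z} → r ≤ s → Bounded r z → Bounded s z
  bounded-weaken {r} {s} {z} r≤s (bounds 0<r-z 0<r+z) = bounds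
    (subst IsPositive (solve 3 (λ r z t → (r :- z) :+ (t :- r) := t :- z) refl (ι r) z (ι s))
      (isPositive-+nonNeg _ 0<r-z (p≤q⇒0≤q-p r≤s)))
    (subst IsPositive (solve 3 (λ r z t → (r :+ z) :+ (t :- r) := t :+ z) refl (ι r) z (ι s))
      (isPositive-+nonNeg _ 0<r+z (p≤q⇒0≤q-p r≤s)))

  -- 2(rs ∓ ab) = (r ∓ a)(s ± b) + (r ± a)(s ∓ b)
  bounded-* : ∀ {r s a b} → Bounded r a → Bounded s b → Bounded (r * s) (a *K b)
  bounded-* {r} {s} {a} {b} (bounds 0<r-a 0<r+a) (bounds 0<s-b 0<s+b) = bounds
    (isPositive-half _ (subst IsPositive lower
      (isPositive-+ _ _ (isPositive-* _ _ 0<r-a 0<s+b) (isPositive-* _ _ 0<r+a 0<s-b))))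
    (isPositive-half _ (subst IsPositive upper
      (isPositive-+ _ _ (isPositive-* _ _ 0<r+a 0<s+b) (isPositive-* _ _ 0<r-a 0<s-b))))
    where
    rs≡r*s : ι r *K ι s ≡ ι (r * s)
    rs≡r*s = sym (ι-homo-* r s)
    lower : (ι r -K a) *K (ι s +K b) +K (ι r +K a) *K (ι s -K b) ≡ (ι (r * s) -K a *K b) +K (ι (r * s) -K a *K b)
    lower = trans (solve 4 (λ r s a b → (r :- a) :* (s :+ b) :+ (r :+ a) :* (s :- b)
                                      := (r :* s :- a :* b) :+ (r :* s :- a :* b)) refl (ι r) (ι s) a b)
                  (cong (λ t → (t -K a *K b) +K (t -K a *K b)) rs≡r*s)
    upper : (ι r +K a) *K (ι s +K b) +K (ι r -K a) *K (ι s -K b) ≡ (ι (r * s) +K a *K b) +K (ι (r * s) +K a *K b)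
    upper = trans (solve 4 (λ r s a b → (r :+ a) :* (s :+ b) :+ (r :- a) :* (s :- b)
                                      := (r :* s :+ a :* b) :+ (r :* s :+ a :* b)) refl (ι r) (ι s) a b)
                  (cong (λ t → (t +K a *K b) +K (t +K a *K b)) rs≡r*s)

  bounded-+ : ∀ {r s a b} → Bounded r a → Bounded s b → Bounded (r + s) (a +K b)
  bounded-+ {r} {s} {a} {b} (bounds 0<r-a 0<r+a) (bounds 0<s-b 0<s+b) = bounds
    (subst IsPositive (solve 4 (λ r s a b → (r :- a) :+ (s :- b) := (r :+ s) :- (a :+ b)) refl (ι r) (ι s) a b)
      (isPositive-+ _ _ 0<r-a 0<s-b))
    (subst IsPositive (solve 4 (λ r s a b → (r :+ a) :+ (s :+ b) := (r :+ s) :+ (a :+ b)) refl (ι r) (ι s) a b)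
      (isPositive-+ _ _ 0<r+a 0<s+b))

  bounded-ι : ∀ x → Σ ℚ λ r → Bounded r (ι x)
  bounded-ι x with ≤-total 0ℚ x
  ... | inj₁ 0≤x = x + 1ℚ , bounds
    (isPositive-ι (subst (0ℚ <_) (sym (lemma x)) 0<1))
    (isPositive-ι (pos+nonNeg (nonNeg+pos 0≤x 0<1) 0≤x))
    where
    lemma : ∀ x → x + 1ℚ - x ≡ 1ℚ
    lemma = solve-∀ ℚ-ring
  ... | inj₂ x≤0 = 1ℚ - x , bounds
    (isPositive-ι (pos+nonNeg (pos+nonNeg 0<1 0≤-x) 0≤-x))
    (isPositive-ι (subst (0ℚ <_) (sym (lemma x)) 0<1))
    where
    0≤-x : 0ℚ ≤ - x
    0≤-x = neg-antimono-≤ x≤0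
    lemma : ∀ x → 1ℚ - x + x ≡ 1ℚ
    lemma = solve-∀ ℚ-ring

  bounded-√d : Bounded D ⟨ 0ℚ , 1ℚ ⟩
  bounded-√d = bounds (re-dominant 0<D+0 (subst (0ℚ <_) (sym (lemma D (- 1ℚ))) 0<D[D-1]))
                      (re-dominant 0<D+0 (subst (0ℚ <_) (sym (lemma D 1ℚ)) 0<D[D-1]))
    where
    0<D+0 : 0ℚ < D + 0ℚ
    0<D+0 = subst (0ℚ <_) (sym (+-identityʳ D)) 0<D
    0<D[D-1] : 0ℚ < D * (D - 1ℚ)
    0<D[D-1] = pos*pos 0<D (p<q⇒0<q-p 1<D)
    lemma : ∀ D e → (D + 0ℚ) * (D + 0ℚ) - D * (0ℚ + e) * (0ℚ + e) ≡ D * (D - e * e)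
    lemma = solve-∀ ℚ-ring

  bounded-exists : ∀ z → Σ ℚ λ r → Bounded r z
  bounded-exists ⟨ x , y ⟩ = proj₁ bx + proj₁ by * D ,
    subst (Bounded (proj₁ bx + proj₁ by * D)) z≡x+y√d (bounded-+ (proj₂ bx) (bounded-* (proj₂ by) bounded-√d))
    where
    bx = bounded-ι x
    by = bounded-ι y
    lemma-re : ∀ D x y → x + (y * 0ℚ + D * 0ℚ * 1ℚ) ≡ x
    lemma-re = solve-∀ ℚ-ring
    lemma-im : ∀ y → 0ℚ + (y * 1ℚ + 0ℚ * 0ℚ) ≡ y
    lemma-im = solve-∀ ℚ-ring
    z≡x+y√d : ι x +K ι y *K ⟨ 0ℚ , 1ℚ ⟩ ≡ ⟨ x , y ⟩
    z≡x+y√d = cong₂ ⟨_,_⟩ (lemma-re D x y) (lemma-im y)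

  -- With a v = n from positive-rational-multiple and v < M:  a − n/M = a (M − v)/M > 0.
  rational-lower-bound : ∀ a → IsPositive a → Σ ℚ λ q → 0ℚ < q × IsPositive (a -K ι q)
  rational-lower-bound a 0<a = n * 1/ M , pos*pos 0<n 0<1/M ,
    subst IsPositive a[M-v]/M≡a-n/M (isPositive-* _ _ (isPositive-* _ _ 0<a (Bounded.below v<M)) (isPositive-ι 0<1/M))
    where
    multiple = positive-rational-multiple a 0<a
    v = proj₁ multiple
    n = proj₁ (proj₂ multiple)
    0<n = proj₁ (proj₂ (proj₂ (proj₂ multiple)))
    av≡n = proj₂ (proj₂ (proj₂ (proj₂ multiple)))
    M = proj₁ (bounded-exists v)
    v<M = proj₂ (bounded-exists v)
    instance _ = pos⇒nonZero M {{ℚ.positive (bounded⇒pos v<M)}}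
    0<1/M : 0ℚ < 1/ M
    0<1/M = positive⁻¹ (1/ M) {{1/pos⇒pos M {{ℚ.positive (bounded⇒pos v<M)}}}}
    a[M-v]/M≡a-n/M : a *K (ι M -K v) *K ι (1/ M) ≡ a -K ι (n * 1/ M)
    a[M-v]/M≡a-n/M = begin
      a *K (ι M -K v) *K ι (1/ M)
        ≡⟨ solve 4 (λ a m v i → a :* (m :- v) :* i := a :* (m :* i) :- a :* v :* i) refl a (ι M) v (ι (1/ M)) ⟩
      a *K (ι M *K ι (1/ M)) -K a *K v *K ι (1/ M)
        ≡⟨ cong₂ (λ s t → a *K s -K t *K ι (1/ M)) (trans (sym (ι-homo-* M (1/ M))) (cong ι (*-inverseʳ M))) av≡n ⟩
      a *K 1K -K ι n *K ι (1/ M)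
        ≡⟨ cong₂ _-K_ (trans (*K-comm a 1K) (*K-identityˡ a)) (sym (ι-homo-* n (1/ M))) ⟩
      a -K ι (n * 1/ M) ∎
      where open ≡-Reasoning

  private
    isPositive-−ι-antitone : ∀ a {q q′} → q′ ≤ q → IsPositive (a -K ι q) → IsPositive (a -K ι q′)
    isPositive-−ι-antitone a {q} {q′} q′≤q 0<a-q =
      subst IsPositive (solve 3 (λ a q q′ → (a :- q) :+ (q :- q′) := a :- q′) refl a (ι q) (ι q′))
        (isPositive-+nonNeg (a -K ι q) 0<a-q (p≤q⇒0≤q-p q′≤q))

    bounded-by-lower-bounds : ∀ s q₁ q₂ → IsPositive ((1K -K s) -K ι q₁) → IsPositive ((1K +K s) -K ι q₂) →
                              Bounded (1ℚ - q₁ ⊓ q₂) s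
    bounded-by-lower-bounds s q₁ q₂ 0<1-s-q₁ 0<1+s-q₂ = bounds
      (subst IsPositive (solve 2 (λ s q → (con (+ 1) :- s) :- q := (con (+ 1) :- q) :- s) refl s (ι (q₁ ⊓ q₂)))
        (isPositive-−ι-antitone (1K -K s) (p⊓q≤p q₁ q₂) 0<1-s-q₁))
      (subst IsPositive (solve 2 (λ s q → (con (+ 1) :+ s) :- q := (con (+ 1) :- q) :+ s) refl s (ι (q₁ ⊓ q₂)))
        (isPositive-−ι-antitone (1K +K s) (p⊓q≤q q₁ q₂) 0<1+s-q₂))

    1-q<1 : ∀ q → 0ℚ < q → 1ℚ - q < 1ℚ
    1-q<1 q 0<q = 0<q-p⇒p<q (subst (0ℚ <_) (sym (lemma q)) 0<q)
      where
      lemma : ∀ q → 1ℚ - (1ℚ - q) ≡ q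
      lemma = solve-∀ ℚ-ring

    0<⊓ : ∀ q₁ q₂ → 0ℚ < q₁ → 0ℚ < q₂ → 0ℚ < q₁ ⊓ q₂
    0<⊓ q₁ q₂ 0<q₁ 0<q₂ with ⊓-sel q₁ q₂
    ... | inj₁ q≡q₁ = subst (0ℚ <_) (sym q≡q₁) 0<q₁
    ... | inj₂ q≡q₂ = subst (0ℚ <_) (sym q≡q₂) 0<q₂

  strict-bound : ∀ {s} → Bounded 1ℚ s → Σ ℚ λ r → r < 1ℚ × Bounded r s
  strict-bound {s} (bounds 0<1-s 0<1+s) =
    combine (rational-lower-bound (1K -K s) 0<1-s) (rational-lower-bound (1K +K s) 0<1+s)
    where
    combine : Σ ℚ (λ q → 0ℚ < q × IsPositive ((1K -K s) -K ι q)) →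
              Σ ℚ (λ q → 0ℚ < q × IsPositive ((1K +K s) -K ι q)) →
              Σ ℚ λ r → r < 1ℚ × Bounded r s
    combine (q₁ , 0<q₁ , 0<1-s-q₁) (q₂ , 0<q₂ , 0<1+s-q₂) =
      1ℚ - q₁ ⊓ q₂ , 1-q<1 (q₁ ⊓ q₂) (0<⊓ q₁ q₂ 0<q₁ 0<q₂) , bounded-by-lower-bounds s q₁ q₂ 0<1-s-q₁ 0<1+s-q₂

  bounded-powers : ∀ {M r c s} → Bounded M c → Bounded r s → ∀ n → Bounded (M * r ^ n) (c *K s ^K n)
  bounded-powers {M} {r} {c} {s} c<M s<r zero =
    subst₂ Bounded (sym (*-identityʳ M)) (sym (trans (*K-comm c 1K) (*K-identityˡ c))) c<M
  bounded-powers {M} {r} {c} {s} c<M s<r (suc n) =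
    subst₂ Bounded (lemma M r (r ^ n)) (solve 3 (λ c s p → c :* p :* s := c :* (s :* p)) refl c s (s ^K n))
      (bounded-* {M * r ^ n} {r} {c *K s ^K n} {s} (bounded-powers c<M s<r n) s<r)
    where
    lemma : ∀ M r p → M * p * r ≡ M * (r * p)
    lemma = solve-∀ ℚ-ring

  bounded-decay : ∀ {s} → Bounded 1ℚ s → ∀ c ε → 0ℚ < ε → ∃ λ N → ∀ n → N ℕ.≤ n → Bounded ε (c *K s ^K n)
  bounded-decay {s} s<1 c ε 0<ε = decay (strict-bound s<1) (bounded-exists c)
    where
    decay : Σ ℚ (λ r → r < 1ℚ × Bounded r s) → Σ ℚ (λ M → Bounded M c) →
            ∃ λ N → ∀ n → N ℕ.≤ n → Bounded ε (c *K s ^K n)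
    decay (r , r<1 , s<r) (M , c<M) = N , λ n N≤n → bounded-weaken (<⇒≤ (Mrⁿ<ε n N≤n)) (bounded-powers c<M s<r n)
      where
      geometric = geometric-decay (<⇒≤ (bounded⇒pos s<r)) r<1 M ε (<⇒≤ (bounded⇒pos c<M)) 0<ε
      N = proj₁ geometric
      Mrⁿ<ε = proj₂ geometric

  bounded⇒between : ∀ {r z} → Bounded r z → (-K ι r) <K z × z <K ι r
  bounded⇒between {r} {z} (bounds 0<r-z 0<r+z) =
    isPositive⇒Pos _ (subst IsPositive (solve 2 (λ r z → r :+ z := z :- (:- r)) refl (ι r) z) 0<r+z) ,
    isPositive⇒Pos _ 0<r-z

  between⇒bounded : ∀ {r z} → (-K ι r) <K z → z <K ι r → Bounded r z
  between⇒bounded {r} {z} -r<z z<r = bounds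
    (Pos⇒isPositive _ z<r)
    (subst IsPositive (solve 2 (λ r z → z :- (:- r) := r :+ z) refl (ι r) z) (Pos⇒isPositive _ -r<z))

module Integrality (d : ℕ) where

  open Arith d
  open QuadraticRing d
  open import Data.Rational using (_+_; _*_; _-_; -_)
  open K-Solver using (solve; _:+_; _:*_; :-_; _:-_; con; _:=_)

  ℤ[_] : K → K → Set
  ℤ[ θ ] z = Σ ℤ λ u → Σ ℤ λ v → z ≡ ιℤ u +K ιℤ v *K θ

  ℤ[θ]-coordinates : ∀ θ u v → ιℤ u +K ιℤ v *K θ ≡ ⟨ fromℤ u + fromℤ v * re θ , fromℤ v * im θ ⟩
  ℤ[θ]-coordinates θ u v = cong₂ ⟨_,_⟩
    (trans (lemma-re (ℚof d) (u / 1) (v / 1) (re θ) (im θ)) (cong₂ (λ s t → s + t * re θ) (m/1≡fromℤ u) (m/1≡fromℤ v)))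
    (trans (lemma-im (v / 1) (re θ) (im θ)) (cong (_* im θ) (m/1≡fromℤ v)))
    where
    lemma-re : ∀ D U V s t → U + (V * s + D * 0ℚ * t) ≡ U + V * s
    lemma-re = solve-∀ ℚ-ring
    lemma-im : ∀ V s t → 0ℚ + (V * t + 0ℚ * s) ≡ V * t
    lemma-im = solve-∀ ℚ-ring

  module _ {θ : K} {e f : ℤ} (θ²≡eθ+f : θ *K θ ≡ ιℤ e *K θ +K ιℤ f) where

    ℤ[θ]-1 : ℤ[ θ ] 1K
    ℤ[θ]-1 = + 1 , + 0 , solve 1 (λ t → con (+ 1) := con (+ 1) :+ con (+ 0) :* t) refl θ

    ℤ[θ]-* : ∀ a b → ℤ[ θ ] a → ℤ[ θ ] b → ℤ[ θ ] (a *K b)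
    ℤ[θ]-* a b (u₁ , v₁ , refl) (u₂ , v₂ , refl) = u , v , (begin
      (U₁ +K V₁ *K θ) *K (U₂ +K V₂ *K θ)
        ≡⟨ solve 7 (λ U₁ V₁ U₂ V₂ E F t → (U₁ :+ V₁ :* t) :* (U₂ :+ V₂ :* t)
                   := (U₁ :* U₂ :+ F :* (V₁ :* V₂)) :+ (U₁ :* V₂ :+ U₂ :* V₁ :+ E :* (V₁ :* V₂)) :* t
                      :+ V₁ :* V₂ :* (t :* t :- (E :* t :+ F))) refl U₁ V₁ U₂ V₂ (ιℤ e) (ιℤ f) θ ⟩
      U +K V *K θ +K V₁ *K V₂ *K (θ *K θ -K (ιℤ e *K θ +K ιℤ f))
        ≡⟨ cong (λ s → U +K V *K θ +K V₁ *K V₂ *K (s -K (ιℤ e *K θ +K ιℤ f))) θ²≡eθ+f ⟩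
      U +K V *K θ +K V₁ *K V₂ *K ((ιℤ e *K θ +K ιℤ f) -K (ιℤ e *K θ +K ιℤ f))
        ≡⟨ solve 3 (λ x w s → x :+ w :* (s :- s) := x) refl (U +K V *K θ) (V₁ *K V₂) (ιℤ e *K θ +K ιℤ f) ⟩
      U +K V *K θ
        ≡⟨ cong₂ (λ s t → s +K t *K θ)
             (solve 0 (con u := con u₁ :* con u₂ :+ con f :* (con v₁ :* con v₂)) refl)
             (solve 0 (con v := con u₁ :* con v₂ :+ con u₂ :* con v₁ :+ con e :* (con v₁ :* con v₂)) refl) ⟨
      ιℤ u +K ιℤ v *K θ ∎)
      where
      open ≡-Reasoning
      U₁ = ιℤ u₁
      V₁ = ιℤ v₁
      U₂ = ιℤ u₂
      V₂ = ιℤ v₂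
      u = u₁ ℤ.* u₂ ℤ.+ f ℤ.* (v₁ ℤ.* v₂)
      v = u₁ ℤ.* v₂ ℤ.+ u₂ ℤ.* v₁ ℤ.+ e ℤ.* (v₁ ℤ.* v₂)
      U = U₁ *K U₂ +K ιℤ f *K (V₁ *K V₂)
      V = U₁ *K V₂ +K U₂ *K V₁ +K ιℤ e *K (V₁ *K V₂)

    ℤ[θ]-^ : ∀ z → ℤ[ θ ] z → ∀ n → ℤ[ θ ] (z ^K n)
    ℤ[θ]-^ z z∈ zero    = ℤ[θ]-1
    ℤ[θ]-^ z z∈ (suc n) = ℤ[θ]-* z (z ^K n) z∈ (ℤ[θ]-^ z z∈ n)

  pure-imaginary-algInt⇒square-isInteger : ∀ z → IsAlgInt z → re z ≡ 0ℚ → IsInteger (re (z *K z))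
  pure-imaginary-algInt⇒square-isInteger ⟨ x , y ⟩ (b , c , eq) refl = ℤ.- c , (begin
    0ℚ * 0ℚ + D * y * y                                                       ≡⟨ lemma D y (b / 1) (c / 1) ⟩
    (0ℚ * 0ℚ + D * y * y + (b / 1 * 0ℚ + D * 0ℚ * y) + c / 1) - c / 1         ≡⟨ cong (_- c / 1) (cong re eq) ⟩
    0ℚ - c / 1                                                                ≡⟨ +-identityˡ (- (c / 1)) ⟩
    - (c / 1)                                                                 ≡⟨ cong -_ (m/1≡fromℤ c) ⟩
    - fromℤ c                                                                 ≡⟨ fromℤ-homo‿- c ⟨
    fromℤ (ℤ.- c)                                                             ∎)
    where
    open ≡-Reasoning
    D = ℚof d
    lemma : ∀ D y B C → 0ℚ * 0ℚ + D * y * y ≡ (0ℚ * 0ℚ + D * y * y + (B * 0ℚ + D * 0ℚ * y) + C) - C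
    lemma = solve-∀ ℚ-ring

  ℤ[θ]-σ : ∀ θ u v → σ (ιℤ u +K ιℤ v *K θ) ≡ ιℤ u +K ιℤ v *K σ θ
  ℤ[θ]-σ θ u v = trans (σ-homo-+ (ιℤ u) (ιℤ v *K θ)) (cong (ιℤ u +K_) (σ-homo-* (ιℤ v) θ))

  -- The integer is the trace z + σ z.
  ℤ[θ]-trace : ∀ θ {e} → θ +K σ θ ≡ ιℤ e → ∀ z → ℤ[ θ ] z → Σ ℤ λ m → z -K ιℤ m ≡ -K σ z
  ℤ[θ]-trace θ {e} θ+σθ≡e z (u , v , refl) = u ℤ.+ u ℤ.+ v ℤ.* e , (begin
    z -K ιℤ (u ℤ.+ u ℤ.+ v ℤ.* e)
      ≡⟨ cong (λ s → z -K s) (solve 0 (con (u ℤ.+ u ℤ.+ v ℤ.* e) := con u :+ con u :+ con v :* con e) refl) ⟩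
    z -K (U +K U +K V *K ιℤ e)
      ≡⟨ cong (λ s → z -K (U +K U +K V *K s)) θ+σθ≡e ⟨
    z -K (U +K U +K V *K (θ +K σ θ))
      ≡⟨ solve 4 (λ U V t s → (U :+ V :* t) :- (U :+ U :+ V :* (t :+ s)) := :- (U :+ V :* s)) refl U V θ (σ θ) ⟩
    -K (U +K V *K σ θ)
      ≡⟨ cong -K_ (ℤ[θ]-σ θ u v) ⟨
    -K σ z ∎)
    where
    open ≡-Reasoning
    U = ιℤ u
    V = ιℤ v

  -- The integer is the θ-coordinate v of z = u + v θ.
  ℤ[θ]-inverse-difference : ∀ θ α → α *K (θ -K σ θ) ≡ 1K →
                            ∀ z → ℤ[ θ ] z → Σ ℤ λ m → α *K z -K ιℤ m ≡ α *K σ z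
  ℤ[θ]-inverse-difference θ α α[θ-σθ]≡1 z (u , v , refl) = v , (begin
    α *K (U +K V *K θ) -K V
      ≡⟨ solve 5 (λ a U V t s → a :* (U :+ V :* t) :- V := a :* (U :+ V :* s) :+ V :* (a :* (t :- s) :- con (+ 1)))
                 refl α U V θ (σ θ) ⟩
    α *K (U +K V *K σ θ) +K V *K (α *K (θ -K σ θ) -K 1K)
      ≡⟨ cong (λ s → α *K (U +K V *K σ θ) +K V *K (s -K 1K)) α[θ-σθ]≡1 ⟩
    α *K (U +K V *K σ θ) +K V *K (1K -K 1K)
      ≡⟨ solve 2 (λ x V → x :+ V :* (con (+ 1) :- con (+ 1)) := x) refl (α *K (U +K V *K σ θ)) V ⟩
    α *K (U +K V *K σ θ)
      ≡⟨ cong (α *K_) (ℤ[θ]-σ θ u v) ⟨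
    α *K σ (U +K V *K θ) ∎)
    where
    open ≡-Reasoning
    U = ιℤ u
    V = ιℤ v

module AlgebraicIntegers (d : ℕ) (sf : SquareFree d) where

  open Arith d
  open QuadraticRing d
  open import Data.Rational using (_+_; _*_; _-_; -_)

  private
    D = ℚof d

  HalfIntegral : K → Set
  HalfIntegral z = Σ ℤ λ u → Σ ℤ λ v →
    re z + re z ≡ fromℤ u × im z + im z ≡ fromℤ v × + 4 ∣ u ℤ.* u ℤ.- + d ℤ.* (v ℤ.* v)

  minimal-equation : ∀ x y → IsAlgInt ⟨ x , y ⟩ → Σ ℤ λ b → Σ ℤ λ c →
    x * x + D * (y * y) + fromℤ b * x + fromℤ c ≡ 0ℚ × y * (x + x + fromℤ b) ≡ 0ℚ
  minimal-equation x y (b , c , eq) = b , c , re-equation , im-equation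
    where
    open ≡-Reasoning
    lemma-re : ∀ D x y B C → x * x + D * (y * y) + B * x + C ≡ x * x + D * y * y + (B * x + D * 0ℚ * y) + C
    lemma-re = solve-∀ ℚ-ring
    lemma-im : ∀ x y B → y * (x + x + B) ≡ x * y + y * x + (B * y + 0ℚ * x) + 0ℚ
    lemma-im = solve-∀ ℚ-ring
    re-equation : x * x + D * (y * y) + fromℤ b * x + fromℤ c ≡ 0ℚ
    re-equation = begin
      x * x + D * (y * y) + fromℤ b * x + fromℤ c
        ≡⟨ cong₂ (λ s t → x * x + D * (y * y) + s * x + t) (m/1≡fromℤ b) (m/1≡fromℤ c) ⟨
      x * x + D * (y * y) + b / 1 * x + c / 1
        ≡⟨ lemma-re D x y (b / 1) (c / 1) ⟩
      x * x + D * y * y + (b / 1 * x + D * 0ℚ * y) + c / 1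
        ≡⟨ cong re eq ⟩
      0ℚ ∎
    im-equation : y * (x + x + fromℤ b) ≡ 0ℚ
    im-equation = begin
      y * (x + x + fromℤ b)                        ≡⟨ cong (λ s → y * (x + x + s)) (m/1≡fromℤ b) ⟨
      y * (x + x + b / 1)                          ≡⟨ lemma-im x y (b / 1) ⟩
      x * y + y * x + (b / 1 * y + 0ℚ * x) + 0ℚ    ≡⟨ cong im eq ⟩
      0ℚ                                           ∎

  private
    rational-halfIntegral : ∀ x y b c → y ≡ 0ℚ → x * x + D * (y * y) + fromℤ b * x + fromℤ c ≡ 0ℚ →
                            HalfIntegral ⟨ x , y ⟩
    rational-halfIntegral x y b c refl eq = m ℤ.+ m , + 0 , x+x≡2m , refl , divides (m ℤ.* m) (lemma m (+ d))
      where
      lemma′ : ∀ D x B C → x * x + B * x + C ≡ x * x + D * (0ℚ * 0ℚ) + B * x + C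
      lemma′ = solve-∀ ℚ-ring
      root = monic-root-isInteger b c x (trans (lemma′ D x (fromℤ b) (fromℤ c)) eq)
      m = proj₁ root
      x+x≡2m : x + x ≡ fromℤ (m ℤ.+ m)
      x+x≡2m = trans (cong (λ t → t + t) (proj₂ root)) (sym (fromℤ-homo-+ m m))
      lemma : ∀ m d → (m ℤ.+ m) ℤ.* (m ℤ.+ m) ℤ.- d ℤ.* (+ 0 ℤ.* + 0) ≡ m ℤ.* m ℤ.* + 4
      lemma = ℤ-Solver.solve-∀

    -- 4 (x² + d y² + b x + c) = (2x + b)² + d (2y)² − (b² − 4c)
    irrational-halfIntegral : ∀ x y b c → x + x + fromℤ b ≡ 0ℚ →
                              x * x + D * (y * y) + fromℤ b * x + fromℤ c ≡ 0ℚ → HalfIntegral ⟨ x , y ⟩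
    irrational-halfIntegral x y b c 2x+b≡0 eq =
      ℤ.- b , v , x+x≡-b , y+y≡v , divides c (trans (cong (λ t → (ℤ.- b) ℤ.* (ℤ.- b) ℤ.- t) dv²≡b²-4c) (lemma b c))
      where
      open ≡-Reasoning
      B = fromℤ b
      C = fromℤ c
      x+x≡-b : x + x ≡ fromℤ (ℤ.- b)
      x+x≡-b = trans (lemma′ (x + x) B) (trans (cong (_- B) 2x+b≡0) (trans (+-identityˡ (- B)) (sym (fromℤ-homo‿- b))))
        where
        lemma′ : ∀ p B → p ≡ p + B - B
        lemma′ = solve-∀ ℚ-ring
      four : ∀ D x y B C → D * ((y + y) * (y + y))
           ≡ (x * x + D * (y * y) + B * x + C) * fromℤ (+ 4) - (x + x + B) * (x + x + B) + (B * B - C * fromℤ (+ 4))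
      four = solve-∀ ℚ-ring
      d[y+y]²≡b²-4c : fromℤ (+ d) * ((y + y) * (y + y)) ≡ fromℤ (b ℤ.* b ℤ.- c ℤ.* + 4)
      d[y+y]²≡b²-4c = begin
        fromℤ (+ d) * ((y + y) * (y + y))          ≡⟨ cong (_* ((y + y) * (y + y))) (m/1≡fromℤ (+ d)) ⟨
        D * ((y + y) * (y + y))                    ≡⟨ four D x y B C ⟩
        _                                          ≡⟨ cong₂ (λ s t → s * fromℤ (+ 4) - t * t + (B * B - C * fromℤ (+ 4)))
                                                             eq 2x+b≡0 ⟩
        0ℚ + (B * B - C * fromℤ (+ 4))            ≡⟨ +-identityˡ _ ⟩
        B * B - C * fromℤ (+ 4)                    ≡⟨ cong₂ _-_ (fromℤ-homo-* b b) (fromℤ-homo-* c (+ 4)) ⟨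
        fromℤ (b ℤ.* b) - fromℤ (c ℤ.* + 4)        ≡⟨ cong (λ t → fromℤ (b ℤ.* b) + t) (fromℤ-homo‿- (c ℤ.* + 4)) ⟨
        fromℤ (b ℤ.* b) + fromℤ (ℤ.- (c ℤ.* + 4)) ≡⟨ fromℤ-homo-+ (b ℤ.* b) (ℤ.- (c ℤ.* + 4)) ⟨
        fromℤ (b ℤ.* b ℤ.- c ℤ.* + 4)              ∎
      y+y-integral = squarefree-isInteger sf (y + y) (b ℤ.* b ℤ.- c ℤ.* + 4 , d[y+y]²≡b²-4c)
      v = proj₁ y+y-integral
      y+y≡v = proj₂ y+y-integral
      dv²≡b²-4c : + d ℤ.* (v ℤ.* v) ≡ b ℤ.* b ℤ.- c ℤ.* + 4
      dv²≡b²-4c = fromℤ-injective (begin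
        fromℤ (+ d ℤ.* (v ℤ.* v))            ≡⟨ trans (fromℤ-homo-* (+ d) (v ℤ.* v))
                                                      (cong (fromℤ (+ d) *_) (fromℤ-homo-* v v)) ⟩
        fromℤ (+ d) * (fromℤ v * fromℤ v)    ≡⟨ cong (λ t → fromℤ (+ d) * (t * t)) y+y≡v ⟨
        fromℤ (+ d) * ((y + y) * (y + y))    ≡⟨ d[y+y]²≡b²-4c ⟩
        fromℤ (b ℤ.* b ℤ.- c ℤ.* + 4)        ∎)
      lemma : ∀ b c → (ℤ.- b) ℤ.* (ℤ.- b) ℤ.- (b ℤ.* b ℤ.- c ℤ.* + 4) ≡ c ℤ.* + 4
      lemma = ℤ-Solver.solve-∀

  algInt-halfIntegral : ∀ z → IsAlgInt z → HalfIntegral z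
  algInt-halfIntegral ⟨ x , y ⟩ z-int = from-equations (minimal-equation x y z-int) (y ≟ 0ℚ)
    where
    from-equations : (Σ ℤ λ b → Σ ℤ λ c →
                       x * x + D * (y * y) + fromℤ b * x + fromℤ c ≡ 0ℚ × y * (x + x + fromℤ b) ≡ 0ℚ) →
                     Dec (y ≡ 0ℚ) → HalfIntegral ⟨ x , y ⟩
    from-equations (b , c , re-eq , im-eq) (yes y≡0) = rational-halfIntegral x y b c y≡0 re-eq
    from-equations (b , c , re-eq , im-eq) (no y≢0) =
      irrational-halfIntegral x y b c (*-zero-divisor y (x + x + fromℤ b) y≢0 im-eq) re-eq

  open Integrality d

  record IntegralBasis : Set where
    field
      θ : K
      e f : ℤ
      θ²≡eθ+f : θ *K θ ≡ ιℤ e *K θ +K ιℤ f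
      θ+σθ≡e : θ +K σ θ ≡ ιℤ e
      θ-σθ≡√dK : θ -K σ θ ≡ sqrtDK d
      algInt⇒ℤ[θ] : ∀ z → IsAlgInt z → ℤ[ θ ] z

  private
    q = d ℕ./ 4
    Q = fromℤ (+ q)
    ½ = + 1 / 2

    D≡1+4q : d ℕ.% 4 ≡ 1 → D ≡ 1ℚ + Q * fromℤ (+ 4)
    D≡1+4q d%4≡1 = begin
      D                              ≡⟨ m/1≡fromℤ (+ d) ⟩
      fromℤ (+ d)                    ≡⟨ cong (λ t → fromℤ (+ t)) (trans (ℕ.m≡m%n+[m/n]*n d 4) (cong (ℕ._+ q ℕ.* 4) d%4≡1)) ⟩
      fromℤ (+ (1 ℕ.+ q ℕ.* 4))      ≡⟨ cong fromℤ (trans (ℤ.pos-+ 1 (q ℕ.* 4)) (cong (λ t → + 1 ℤ.+ t) (ℤ.pos-* q 4))) ⟩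
      fromℤ (+ 1 ℤ.+ + q ℤ.* + 4)    ≡⟨ trans (fromℤ-homo-+ (+ 1) (+ q ℤ.* + 4))
                                              (cong (λ t → 1ℚ + t) (fromℤ-homo-* (+ q) (+ 4))) ⟩
      1ℚ + Q * fromℤ (+ 4)           ∎
      where open ≡-Reasoning

  ω : K
  ω = ⟨ ½ , ½ ⟩

  √d : K
  √d = ⟨ 0ℚ , 1ℚ ⟩

  ω²≡ω+q : d ℕ.% 4 ≡ 1 → ω *K ω ≡ ιℤ (+ 1) *K ω +K ιℤ (+ q)
  ω²≡ω+q d%4≡1 = cong₂ ⟨_,_⟩ (begin
    ½ * ½ + D * ½ * ½                             ≡⟨ cong (λ t → ½ * ½ + t * ½ * ½) (D≡1+4q d%4≡1) ⟩
    ½ * ½ + (1ℚ + Q * fromℤ (+ 4)) * ½ * ½        ≡⟨ lemma Q ⟩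
    1ℚ * ½ + (1ℚ + Q * fromℤ (+ 4)) * 0ℚ * ½ + Q  ≡⟨ cong₂ (λ s t → 1ℚ * ½ + s * 0ℚ * ½ + t)
                                                           (D≡1+4q d%4≡1) (m/1≡fromℤ (+ q)) ⟨
    1ℚ * ½ + D * 0ℚ * ½ + + q / 1                 ∎) refl
    where
    open ≡-Reasoning
    lemma : ∀ Q → ½ * ½ + (1ℚ + Q * fromℤ (+ 4)) * ½ * ½ ≡ 1ℚ * ½ + (1ℚ + Q * fromℤ (+ 4)) * 0ℚ * ½ + Q
    lemma = solve-∀ ℚ-ring

  √d²≡d : √d *K √d ≡ ιℤ (+ 0) *K √d +K ιℤ (+ d)
  √d²≡d = cong₂ ⟨_,_⟩ (lemma D) refl
    where
    lemma : ∀ D → 0ℚ * 0ℚ + D * 1ℚ * 1ℚ ≡ 0ℚ * 0ℚ + D * 0ℚ * 1ℚ + D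
    lemma = solve-∀ ℚ-ring

  halfIntegral⇒ℤ[ω] : d ℕ.% 4 ≡ 1 → ∀ z → HalfIntegral z → ℤ[ ω ] z
  halfIntegral⇒ℤ[ω] d%4≡1 ⟨ x , y ⟩ (u , v , x+x≡u , y+y≡v , 4∣u²-dv²) =
    j , v , trans (cong₂ ⟨_,_⟩ x≡j+v/2 y≡v/2) (sym (ℤ[θ]-coordinates ω j v))
    where
    open ≡-Reasoning
    2∣u-v = mod4≡1⇒2∣u-v d d%4≡1 u v 4∣u²-dv²
    j = _∣_.quotient 2∣u-v
    J = fromℤ j
    V = fromℤ v
    u≡2j+v : u ≡ j ℤ.* + 2 ℤ.+ v
    u≡2j+v = trans (lemma u v) (cong (ℤ._+ v) (_∣_.equality 2∣u-v))
      where
      lemma : ∀ u v → u ≡ u ℤ.- v ℤ.+ v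
      lemma = ℤ-Solver.solve-∀
    x≡j+v/2 : x ≡ J + V * ½
    x≡j+v/2 = halve x (J + V * ½) (begin
      x + x                      ≡⟨ x+x≡u ⟩
      fromℤ u                    ≡⟨ cong fromℤ u≡2j+v ⟩
      fromℤ (j ℤ.* + 2 ℤ.+ v)    ≡⟨ trans (fromℤ-homo-+ (j ℤ.* + 2) v) (cong (_+ V) (fromℤ-homo-* j (+ 2))) ⟩
      J * fromℤ (+ 2) + V        ≡⟨ lemma J V ⟩
      (J + V * ½) + (J + V * ½)  ∎)
      where
      lemma : ∀ J V → J * fromℤ (+ 2) + V ≡ (J + V * ½) + (J + V * ½)
      lemma = solve-∀ ℚ-ring
    y≡v/2 : y ≡ V * ½
    y≡v/2 = halve y (V * ½) (trans y+y≡v (lemma V))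
      where
      lemma : ∀ V → V ≡ V * ½ + V * ½
      lemma = solve-∀ ℚ-ring

  halfIntegral⇒ℤ[√d] : d ℕ.% 4 ≡ 2 ⊎ d ℕ.% 4 ≡ 3 → ∀ z → HalfIntegral z → ℤ[ √d ] z
  halfIntegral⇒ℤ[√d] d%4∈ ⟨ x , y ⟩ (u , v , x+x≡u , y+y≡v , 4∣u²-dv²) =
    i , j , trans (cong₂ ⟨_,_⟩ (trans (halve-2∣ x u x+x≡u 2∣u) (lemma (fromℤ i) (fromℤ j)))
                               (trans (halve-2∣ y v y+y≡v 2∣v) (sym (*-identityʳ (fromℤ j)))))
                  (sym (ℤ[θ]-coordinates √d i j))
    where
    2∣u = proj₁ (mod4≡2,3⇒even d d%4∈ u v 4∣u²-dv²)
    2∣v = proj₂ (mod4≡2,3⇒even d d%4∈ u v 4∣u²-dv²)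
    i = _∣_.quotient 2∣u
    j = _∣_.quotient 2∣v
    lemma : ∀ I J → I ≡ I + J * 0ℚ
    lemma = solve-∀ ℚ-ring

  basis₁ : d ℕ.% 4 ≡ 1 → IntegralBasis
  basis₁ d%4≡1 = record
    { θ = ω
    ; e = + 1
    ; f = + q
    ; θ²≡eθ+f = ω²≡ω+q d%4≡1
    ; θ+σθ≡e = refl
    ; θ-σθ≡√dK = cong sqrtDKaux (sym d%4≡1)
    ; algInt⇒ℤ[θ] = λ z → halfIntegral⇒ℤ[ω] d%4≡1 z ∘ algInt-halfIntegral z
    }

  basis₂₃ : d ℕ.% 4 ≡ 2 ⊎ d ℕ.% 4 ≡ 3 → IntegralBasis
  basis₂₃ d%4∈ = record
    { θ = √d
    ; e = + 0
    ; f = + d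
    ; θ²≡eθ+f = √d²≡d
    ; θ+σθ≡e = refl
    ; θ-σθ≡√dK = √d-σ√d≡√dK d%4∈
    ; algInt⇒ℤ[θ] = λ z → halfIntegral⇒ℤ[√d] d%4∈ z ∘ algInt-halfIntegral z
    }
    where
    √d-σ√d≡√dK : d ℕ.% 4 ≡ 2 ⊎ d ℕ.% 4 ≡ 3 → √d -K σ √d ≡ sqrtDK d
    √d-σ√d≡√dK (inj₁ d%4≡2) = cong sqrtDKaux (sym d%4≡2)
    √d-σ√d≡√dK (inj₂ d%4≡3) = cong sqrtDKaux (sym d%4≡3)

  d%4≢0 : d ℕ.% 4 ≢ 0
  d%4≢0 d%4≡0 with sf 2 (ℕ.divides q (trans (ℕ.m≡m%n+[m/n]*n d 4) (cong (ℕ._+ q ℕ.* 4) d%4≡0)))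
  ... | ()

  integralBasis : IntegralBasis
  integralBasis with d ℕ.% 4 in d%4≡r
  ... | 0 = ⊥-elim (d%4≢0 d%4≡r)
  ... | 1 = basis₁ d%4≡r
  ... | 2 = basis₂₃ (inj₁ d%4≡r)
  ... | 3 = basis₂₃ (inj₂ d%4≡r)
  ... | suc (suc (suc (suc r))) = ⊥-elim (ℕ.m+n≮m 4 r (subst (ℕ._< 4) d%4≡r (ℕ.m%n<n d 4)))

module PisotApproximation (d : ℕ) (1<d : 1 ℕ.< d) (sf : SquareFree d) where

  open Arith d
  open QuadraticRing d
  open import Data.Rational using (_+_; _*_; _-_; -_)
  open RealEmbedding d 1<d sf
  open Integrality d
  open AlgebraicIntegers d sf
  open IntegralBasis integralBasis
  open K-Solver using (solve; _:+_; _:*_; :-_; _:-_; con; _:=_)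

  conjugate-error⇒InM : ∀ ζ α c → Bounded 1ℚ (σ ζ) →
                        (∀ n → Σ ℤ λ m → α *K ζ ^K n -K ιℤ m ≡ c *K σ ζ ^K n) → InM ζ α
  conjugate-error⇒InM ζ α c σζ<1 error ε 0<ε = N , λ n N≤n →
    proj₁ (error n) , bounded⇒between (subst (Bounded ε) (sym (proj₂ (error n))) (decay n N≤n))
    where
    N = proj₁ (bounded-decay σζ<1 c ε 0<ε)
    decay = proj₂ (bounded-decay σζ<1 c ε 0<ε)

  pisot⇒∣σζ∣<1 : ∀ ζ → IsPisotK ζ → Bounded 1ℚ (σ ζ)
  pisot⇒∣σζ∣<1 ζ (_ , _ , _ , -1<σζ , σζ<1) = between⇒bounded -1<σζ σζ<1

  pisot-powers∈ℤ[θ] : ∀ ζ → IsPisotK ζ → ∀ n → ℤ[ θ ] (ζ ^K n)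
  pisot-powers∈ℤ[θ] ζ pisot = ℤ[θ]-^ {θ} {e} {f} θ²≡eθ+f ζ (algInt⇒ℤ[θ] ζ (proj₁ pisot))

  inverse-√dK∈M : ∀ ζ → IsPisotK ζ → ∀ α → α *K sqrtDK d ≡ 1K → InM ζ α
  inverse-√dK∈M ζ pisot α α√dK≡1 = conjugate-error⇒InM ζ α α (pisot⇒∣σζ∣<1 ζ pisot) λ n →
    let (m , error) = ℤ[θ]-inverse-difference θ α α[θ-σθ]≡1 (ζ ^K n) (pisot-powers∈ℤ[θ] ζ pisot n)
    in m , trans error (cong (α *K_) (σ-homo-^ ζ n))
    where
    α[θ-σθ]≡1 : α *K (θ -K σ θ) ≡ 1K
    α[θ-σθ]≡1 = trans (cong (α *K_) θ-σθ≡√dK) α√dK≡1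

  algInt∈M : ∀ α → IsAlgInt α → ∀ ζ → IsPisotK ζ → InM ζ α
  algInt∈M α α-int ζ pisot = conjugate-error⇒InM ζ α (-K σ α) (pisot⇒∣σζ∣<1 ζ pisot) λ n →
    let (m , error) = ℤ[θ]-trace θ {e} θ+σθ≡e (α *K ζ ^K n)
                        (ℤ[θ]-* {θ} {e} {f} θ²≡eθ+f α (ζ ^K n) (algInt⇒ℤ[θ] α α-int) (pisot-powers∈ℤ[θ] ζ pisot n))
    in m , trans error (trans (cong -K_ (trans (σ-homo-* α (ζ ^K n)) (cong (σ α *K_) (σ-homo-^ ζ n))))
                              (solve 2 (λ a z → :- (a :* z) := (:- a) :* z) refl (σ α) (σ ζ ^K n)))

  1<dK : 1 ℕ.< dK d
  1<dK with d ℕ.% 4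
  ... | 1           = 1<d
  ... | zero        = ℕ.<-≤-trans 1<d (ℕ.m≤n*m d 4)
  ... | suc (suc _) = ℕ.<-≤-trans 1<d (ℕ.m≤n*m d 4)

  re-√dK : re (sqrtDK d) ≡ 0ℚ
  re-√dK with d ℕ.% 4
  ... | 1           = refl
  ... | zero        = refl
  ... | suc (suc _) = refl

  private
    2√d² : ⟨ 0ℚ , ℚof 2 ⟩ *K ⟨ 0ℚ , ℚof 2 ⟩ ≡ ι (fromℤ (+ (4 ℕ.* d)))
    2√d² = cong₂ ⟨_,_⟩ (begin
      0ℚ * 0ℚ + ℚof d * ℚof 2 * ℚof 2   ≡⟨ lemma (ℚof d) ⟩
      fromℤ (+ 4) * ℚof d               ≡⟨ cong (fromℤ (+ 4) *_) (m/1≡fromℤ (+ d)) ⟩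
      fromℤ (+ 4) * fromℤ (+ d)         ≡⟨ fromℤ-homo-* (+ 4) (+ d) ⟨
      fromℤ (+ 4 ℤ.* + d)               ≡⟨ cong fromℤ (ℤ.pos-* 4 d) ⟨
      fromℤ (+ (4 ℕ.* d))               ∎) refl
      where
      open ≡-Reasoning
      lemma : ∀ D → 0ℚ * 0ℚ + D * ℚof 2 * ℚof 2 ≡ fromℤ (+ 4) * D
      lemma = solve-∀ ℚ-ring

  √dK² : sqrtDK d *K sqrtDK d ≡ ι (fromℤ (+ dK d))
  √dK² with d ℕ.% 4
  ... | 1           = cong₂ ⟨_,_⟩ (trans (lemma (ℚof d)) (m/1≡fromℤ (+ d))) refl
    where
    lemma : ∀ D → 0ℚ * 0ℚ + D * 1ℚ * 1ℚ ≡ D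
    lemma = solve-∀ ℚ-ring
  ... | zero        = 2√d²
  ... | suc (suc _) = 2√d²

  private
    Dₖ = fromℤ (+ dK d)
    0<Dₖ : 0ℚ ℚ.< Dₖ
    0<Dₖ = fromℤ-mono-< (ℤ.+<+ (ℕ.<-trans (ℕ.s≤s ℕ.z≤n) 1<dK))
    instance _ = pos⇒nonZero Dₖ {{ℚ.positive 0<Dₖ}}

  inverse-√dK : K
  inverse-√dK = ι (1/ Dₖ) *K sqrtDK d

  inverse-√dK*√dK≡1 : inverse-√dK *K sqrtDK d ≡ 1K
  inverse-√dK*√dK≡1 = begin
    ι (1/ Dₖ) *K sqrtDK d *K sqrtDK d      ≡⟨ *K-assoc (ι (1/ Dₖ)) (sqrtDK d) (sqrtDK d) ⟩
    ι (1/ Dₖ) *K (sqrtDK d *K sqrtDK d)    ≡⟨ cong (ι (1/ Dₖ) *K_) √dK² ⟩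
    ι (1/ Dₖ) *K ι Dₖ                      ≡⟨ ι-homo-* (1/ Dₖ) Dₖ ⟨
    ι (1/ Dₖ * Dₖ)                         ≡⟨ cong ι (*-inverseˡ Dₖ) ⟩
    1K                                     ∎
    where open ≡-Reasoning

  inverse-√dK-not-algInt : ¬ IsAlgInt inverse-√dK
  inverse-√dK-not-algInt β-int = reciprocal-not-integer (1/ Dₖ) 1<dK (*-inverseˡ Dₖ)
    (subst IsInteger (cong re β²≡1/dK) (pure-imaginary-algInt⇒square-isInteger inverse-√dK β-int re-β≡0))
    where
    re-β≡0 : re inverse-√dK ≡ 0ℚ
    re-β≡0 = trans (cong (λ t → 1/ Dₖ * t + ℚof d * 0ℚ * im (sqrtDK d)) re-√dK) (lemma (1/ Dₖ) (ℚof d) (im (sqrtDK d)))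
      where
      lemma : ∀ i D s → i * 0ℚ + D * 0ℚ * s ≡ 0ℚ
      lemma = solve-∀ ℚ-ring
    β²≡1/dK : inverse-√dK *K inverse-√dK ≡ ι (1/ Dₖ)
    β²≡1/dK = begin
      ι (1/ Dₖ) *K sqrtDK d *K (ι (1/ Dₖ) *K sqrtDK d)
        ≡⟨ solve 2 (λ i s → i :* s :* (i :* s) := i :* (i :* (s :* s))) refl (ι (1/ Dₖ)) (sqrtDK d) ⟩
      ι (1/ Dₖ) *K (ι (1/ Dₖ) *K (sqrtDK d *K sqrtDK d))
        ≡⟨ cong (λ t → ι (1/ Dₖ) *K (ι (1/ Dₖ) *K t)) √dK² ⟩
      ι (1/ Dₖ) *K (ι (1/ Dₖ) *K ι Dₖ)
        ≡⟨ cong (ι (1/ Dₖ) *K_) (trans (sym (ι-homo-* (1/ Dₖ) Dₖ)) (cong ι (*-inverseˡ Dₖ))) ⟩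
      ι (1/ Dₖ) *K 1K
        ≡⟨ trans (*K-comm (ι (1/ Dₖ)) 1K) (*K-identityˡ (ι (1/ Dₖ))) ⟩
      ι (1/ Dₖ) ∎
      where open ≡-Reasoning

open import Data.Nat using (_<_)

theorem3p28 : (d : ℕ) → 1 < d → SquareFree d →
    let open Arith d in
      ((ζ : K) → IsPisotK ζ → (α : K) → α *K sqrtDK d ≡ 1K → InM ζ α)
    × (((α : K) → IsAlgInt α → (ζ : K) → IsPisotK ζ → InM ζ α)
      × Σ K (λ β → ((ζ : K) → IsPisotK ζ → InM ζ β) × ¬ IsAlgInt β))
theorem3p28 d 1<d sf =
  inverse-√dK∈M ,
  algInt∈M ,
  inverse-√dK , (λ ζ pisot → inverse-√dK∈M ζ pisot inverse-√dK inverse-√dK*√dK≡1) , inverse-√dK-not-algInt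
  where open PisotApproximation d 1<d sf
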